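{- Let $\Delta$ be a $(d-1)$-dimensional Boolean cell complex. Then for $0 \leq j \leq d$, $$h_j^{\mathrm{sd}(\Delta)} = \sum_{r=0}^{d} A(d+1,j,r+1)\, h_r^\Delta.$$
   Context: A Boolean cell complex is a regular CW-complex $\Delta$, regarded as the poset of its cells (faces) ordered by closure containment, with the empty cell included as least element, such that every lower interval $[\emptyset, A]$ is a Boolean lattice. For a $(d-1)$-dimensional Boolean cell complex, $f_{i}^\Delta$ ($-1 \le i \le d-1$) is the number of $i$-dimensional faces ($f_{ -1}^\Delta=1$), and the $h$-vector is defined by $\sum_{i=0}^d h_i^\Delta t^{d-i} = \sum_{i=0}^d f_{i-1}^\Delta (t-1)^{d-i}$. The barycentric subdivision $\mathrm{sd}(\Delta)$ is the simplicial complex whose vertices are the non-empty faces of $\Delta$ and whose faces are strictly increasing chains of non-empty faces. For $\sigma$ in the symmetric group $S_m$, $\mathrm{des}(\sigma) = \#\{ i \in [m-1] : \sigma(i) > \sigma(i+1)\}$. For $m \ge 1$ and integers $i,j$, $A(m,i,j)$ denotes the number of $\sigma \in S_m$ with $\sigma(1)=j$ and $\mathrm{des}(\sigma) = i$ (so $A(m,i,j)=0$ if $i\le -1$, $i \ge m$, or $j\notin[m]$). -}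

module Defs where

open import Data.Nat using (ℕ; zero; suc; _+_; _∸_; _<ᵇ_; _≤_)
open import Data.Nat.Combinatorics using (_C_)
open import Data.Bool using (Bool; true; false; _∧_; not; if_then_else_)
open import Data.Fin using (Fin; toℕ; _≟_)
open import Data.Fin.Subset using (Subset; _⊆_)
open import Data.List using (List; []; _∷_; map; concatMap; filter; length; upTo; allFin; foldr)
open import Data.Vec using (Vec; []; _∷_)
open import Data.Integer using (ℤ; +_; -[1+_]) renaming (_+_ to _+ℤ_; _*_ to _*ℤ_)
open import Data.Product using (Σ; _×_; _,_; ∃)
open import Function.Bundles using (_⇔_)
open import Relation.Binary.PropositionalEquality using (_≡_; _≢_)
open import Relation.Nullary using (Dec; yes; no)
open import Relation.Nullary.Decidable using (⌊_⌋)

allVecs : (n k : ℕ) → List (Vec (Fin n) k)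
allVecs n zero    = [] ∷ []
allVecs n (suc k) = concatMap (λ x → map (x ∷_) (allVecs n k)) (allFin n)

count : {A : Set} → (A → Bool) → List A → ℕ
count p []       = 0
count p (x ∷ xs) = if p x then suc (count p xs) else count p xs

sumTo : ℕ → (ℕ → ℤ) → ℤ
sumTo m g = foldr (λ i acc → g i +ℤ acc) (+ 0) (upTo (suc m))

sign : ℕ → ℤ
sign zero          = + 1
sign (suc zero)    = -[1+ 0 ]
sign (suc (suc k)) = sign k

distinct? : {m k : ℕ} → Vec (Fin m) k → Bool
distinct? []       = true
distinct? (x ∷ xs) = notIn x xs ∧ distinct? xs
  where
  notIn : {m k : ℕ} → Fin m → Vec (Fin m) k → Bool
  notIn x []       = true
  notIn x (y ∷ ys) = not ⌊ x ≟ y ⌋ ∧ notIn x ys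

des : {m k : ℕ} → Vec (Fin m) k → ℕ
des []                = 0
des (x ∷ [])          = 0
des (x ∷ y ∷ xs)      = (if toℕ y <ᵇ toℕ x then 1 else 0) + des (y ∷ xs)

first : {m k : ℕ} → Vec (Fin m) k → ℕ
first []      = 0
first (x ∷ _) = suc (toℕ x)

-- Permutations σ ∈ S_m, in one-line notation (σ(1),…,σ(m)), are the
-- words of length m over [m] with pairwise distinct letters.
-- A m i j = #{σ ∈ S_m : σ(1) = j, des σ = i}   (j is 1-based)
A : ℕ → ℕ → ℕ → ℕ
A m i j = count (λ σ → distinct? σ ∧ ⌊ first σ Data.Nat.≟ j ⌋ ∧ ⌊ des σ Data.Nat.≟ i ⌋)
                (allVecs m m)

-- Boolean cell complexes (as posets of cells, empty cell included)

record BooleanCellComplex (n : ℕ) : Set₁ where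
  field
    -- cells are Fin n, ordered by closure containment
    _≼_     : Fin n → Fin n → Set
    _≼?_    : (x y : Fin n) → Dec (x ≼ y)
    ≼-refl  : ∀ x → x ≼ x
    ≼-antisym : ∀ {x y} → x ≼ y → y ≼ x → x ≡ y
    ≼-trans : ∀ {x y z} → x ≼ y → y ≼ z → x ≼ z
    ∅       : Fin n
    ∅-least : ∀ x → ∅ ≼ x
    -- every lower interval [∅ , a] is a Boolean lattice: it is
    -- order-isomorphic (via φ a) to the lattice of subsets of [rank a]
    rank    : Fin n → ℕ
    φ       : (a : Fin n) → Subset (rank a) → Fin n
    φ-below : ∀ a S → φ a S ≼ a
    φ-onto  : ∀ a x → x ≼ a → ∃ λ S → φ a S ≡ x
    φ-order : ∀ a S T → (S ⊆ T) ⇔ (φ a S ≼ φ a T)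

module _ {n : ℕ} (Δ : BooleanCellComplex n) where
  open BooleanCellComplex Δ

  -- dimension of a cell a is rank a - 1; Δ is (d-1)-dimensional
  IsDim : ℕ → Set
  IsDim d = (∀ a → rank a ≤ d) × (∃ λ a → rank a ≡ d)

  -- fΔ i = f_{i-1}^Δ = number of cells of dimension i-1
  fΔ : ℕ → ℕ
  fΔ i = count (λ a → ⌊ rank a Data.Nat.≟ i ⌋) (allFin n)

  chain? : {k : ℕ} → Vec (Fin n) k → Bool
  chain? []           = true
  chain? (x ∷ [])     = not ⌊ x ≟ ∅ ⌋
  chain? (x ∷ y ∷ xs) = not ⌊ x ≟ ∅ ⌋ ∧ ⌊ x ≼? y ⌋ ∧ not ⌊ x ≟ y ⌋ ∧ chain? (y ∷ xs)

  -- fsd i = f_{i-1}^{sd Δ} = number of faces of sd(Δ) with i vertices,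
  -- i.e. strictly increasing chains x₁ < … < x_i of non-empty cells
  fsd : ℕ → ℕ
  fsd i = count chain? (allVecs n i)

-- h-vector of a (d-1)-dimensional complex with f i = f_{i-1}:
-- coefficient of t^{d-j} in Σ_i f_{i-1} (t-1)^{d-i}, i.e.
-- h_j = Σ_{i=0}^{j} (-1)^{j-i} C(d-i, j-i) f_{i-1}
hvec : ℕ → (ℕ → ℕ) → ℕ → ℤ
hvec d f j = sumTo j (λ i → sign (j ∸ i) *ℤ (+ ((d ∸ i) C (j ∸ i)) *ℤ + f i))

module Submission where

-- Grouping the chains x₁ < ⋯ < x_k of non-empty cells by their top cell a, whose lower interval is
-- the lattice of subsets of [r] with r = rank a, gives f_{k-1}(sd Δ) = Σ_i f_{i-1}(Δ) s(i,k), where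
-- s(i,k) counts the surjections [i] ↠ [k].  Both sides of the theorem are therefore linear in the
-- f-vector of Δ, and it suffices to compare, for each i ≤ d, the generating functions in t of the
-- contributions of a single cell with i vertices,
--   Σ_k s(i,k) t^k (1-t)^(d-k)   and   Σ_r A_{d+1,r+1}(t) [t^r] t^i (1-t)^(d-i),
-- where A_{m,r}(t) = Σ_j A(m,j,r) t^j.  For i ≤ d both get multiplied
-- by 1 - t when d grows: on the right by summation by parts, since
-- A(d+2,j,r+1) - A(d+2,j,r+2) = A(d+1,j,r+1) - A(d+1,j-1,r+1).  For i = d + 1 both become
-- t Σ_{i′} C(d+1,i′) times the contributions for d, by the recursion of s and by
-- Σ_{i<N} C(N,i) t^i (1-t)^(N-1-i) = 1 + t + ⋯ + t^(N-1).

open import Algebra.Bundles using (CommutativeSemiring)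
open import Data.Fin using (Fin)
open import Data.Nat using (ℕ)
import Data.Nat.Properties as ℕP
import Data.Integer.Properties as ℤP
open import Defs using (BooleanCellComplex)

module RangeSum {c ℓ} (R : CommutativeSemiring c ℓ) where

  open import Data.Bool using (Bool; true; false; _∧_)
  open import Data.Fin using (Fin; zero; suc; toℕ)
  import Data.Fin.Properties as F
  open import Data.Nat as ℕ using (ℕ; zero; suc; _≤_; _<_; z≤n; s≤s; _≡ᵇ_)
  open import Function using (_∘_)
  import Relation.Binary.PropositionalEquality as ≡
  open import Relation.Binary.PropositionalEquality using (_≢_)
  open import Relation.Nullary using (does)

  open CommutativeSemiring R hiding (zero)
  open import Algebra.Properties.CommutativeSemigroup +-commutativeSemigroup using (xy∙z≈zy∙x)
  open import Algebra.Properties.Semiring.Sum semiring public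
    using ( sum; sum-syntax; sum-cong-≗; sum-cong-≋; sum-replicate-zero
          ; ∑-comm; ∑-distrib-+; *-distribˡ-sum; *-distribʳ-sum)
  open import Relation.Binary.Reasoning.Setoid setoid

  Σ< : ℕ → (ℕ → Carrier) → Carrier
  Σ< n f = sum {n} (f ∘ toℕ)

  indicator : Bool → Carrier
  indicator true  = 1#
  indicator false = 0#

  indicator-∧ : ∀ a b → indicator (a ∧ b) ≈ indicator a * indicator b
  indicator-∧ true  b = sym (*-identityˡ _)
  indicator-∧ false b = sym (zeroˡ _)

  -- multiplication by t, on coefficient sequences
  shift : (ℕ → Carrier) → ℕ → Carrier
  shift f zero    = 0#
  shift f (suc j) = f j

  Σ<-cong : ∀ n {f g : ℕ → Carrier} → (∀ i → i < n → f i ≈ g i) → Σ< n f ≈ Σ< n g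
  Σ<-cong zero    f≈g = refl
  Σ<-cong (suc n) f≈g = +-cong (f≈g 0 (s≤s z≤n)) (Σ<-cong n (λ i i<n → f≈g (suc i) (s≤s i<n)))

  Σ<-zero : ∀ n {f : ℕ → Carrier} → (∀ i → i < n → f i ≈ 0#) → Σ< n f ≈ 0#
  Σ<-zero n f≈0 = trans (Σ<-cong n f≈0) (sum-replicate-zero n)

  Σ<-distrib-+ : ∀ n (f g : ℕ → Carrier) → Σ< n (λ i → f i + g i) ≈ Σ< n f + Σ< n g
  Σ<-distrib-+ n f g = ∑-distrib-+ {n} (f ∘ toℕ) (g ∘ toℕ)

  Σ<-comm : ∀ m n (f : ℕ → ℕ → Carrier) → Σ< m (λ i → Σ< n (f i)) ≈ Σ< n (λ j → Σ< m (λ i → f i j))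
  Σ<-comm m n f = ∑-comm {m} {n} (λ i j → f (toℕ i) (toℕ j))

  *-distribˡ-Σ< : ∀ n x (f : ℕ → Carrier) → x * Σ< n f ≈ Σ< n (λ i → x * f i)
  *-distribˡ-Σ< n x f = *-distribˡ-sum {n} x (f ∘ toℕ)

  *-distribʳ-Σ< : ∀ n x (f : ℕ → Carrier) → Σ< n f * x ≈ Σ< n (λ i → f i * x)
  *-distribʳ-Σ< n x f = *-distribʳ-sum {n} x (f ∘ toℕ)

  Σ<-*-Σ<-comm : ∀ m n (u : ℕ → Carrier) (v : ℕ → ℕ → Carrier) (c : ℕ → Carrier) →
    Σ< m (λ x → u x * Σ< n (λ y → v x y * c y)) ≈ Σ< n (λ y → Σ< m (λ x → u x * v x y) * c y)
  Σ<-*-Σ<-comm m n u v c = begin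
    Σ< m (λ x → u x * Σ< n (λ y → v x y * c y))
      ≈⟨ Σ<-cong m (λ x _ → *-distribˡ-Σ< n (u x) (λ y → v x y * c y)) ⟩
    Σ< m (λ x → Σ< n (λ y → u x * (v x y * c y)))
      ≈⟨ Σ<-comm m n (λ x y → u x * (v x y * c y)) ⟩
    Σ< n (λ y → Σ< m (λ x → u x * (v x y * c y)))
      ≈⟨ Σ<-cong n (λ y _ → Σ<-cong m (λ x _ → sym (*-assoc (u x) (v x y) (c y)))) ⟩
    Σ< n (λ y → Σ< m (λ x → u x * v x y * c y))
      ≈⟨ Σ<-cong n (λ y _ → *-distribʳ-Σ< m (c y) (λ x → u x * v x y)) ⟨
    Σ< n (λ y → Σ< m (λ x → u x * v x y) * c y)
      ∎

  Σ<-split : ∀ m n (f : ℕ → Carrier) → Σ< (m ℕ.+ n) f ≈ Σ< m f + Σ< n (λ i → f (m ℕ.+ i))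
  Σ<-split zero    n f = sym (+-identityˡ _)
  Σ<-split (suc m) n f = begin
    f 0 + Σ< (m ℕ.+ n) (f ∘ suc)                          ≈⟨ +-congˡ (Σ<-split m n (f ∘ suc)) ⟩
    f 0 + (Σ< m (f ∘ suc) + Σ< n (λ i → f (suc m ℕ.+ i))) ≈⟨ sym (+-assoc _ _ _) ⟩
    Σ< (suc m) f + Σ< n (λ i → f (suc m ℕ.+ i))           ∎

  Σ<-last : ∀ n (f : ℕ → Carrier) → Σ< (suc n) f ≈ Σ< n f + f n
  Σ<-last n f = begin
    Σ< (suc n) f                  ≡⟨ ≡.cong (λ m → Σ< m f) (ℕP.+-comm n 1) ⟨
    Σ< (n ℕ.+ 1) f                ≈⟨ Σ<-split n 1 f ⟩
    Σ< n f + (f (n ℕ.+ 0) + 0#)   ≈⟨ +-congˡ (+-identityʳ _) ⟩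
    Σ< n f + f (n ℕ.+ 0)          ≡⟨ ≡.cong (λ m → Σ< n f + f m) (ℕP.+-identityʳ n) ⟩
    Σ< n f + f n                  ∎

  Σ<-truncate : ∀ {m n} (f : ℕ → Carrier) → m ≤ n → (∀ i → m ≤ i → i < n → f i ≈ 0#) → Σ< n f ≈ Σ< m f
  Σ<-truncate {m} {n} f m≤n tail≈0 = begin
    Σ< n f                                    ≡⟨ ≡.cong (λ k → Σ< k f) (ℕP.m+[n∸m]≡n m≤n) ⟨
    Σ< (m ℕ.+ (n ℕ.∸ m)) f                    ≈⟨ Σ<-split m (n ℕ.∸ m) f ⟩
    Σ< m f + Σ< (n ℕ.∸ m) (λ i → f (m ℕ.+ i)) ≈⟨ +-congˡ (Σ<-zero (n ℕ.∸ m) tail′≈0) ⟩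
    Σ< m f + 0#                               ≈⟨ +-identityʳ _ ⟩
    Σ< m f                                    ∎
    where
    tail′≈0 : ∀ i → i < n ℕ.∸ m → f (m ℕ.+ i) ≈ 0#
    tail′≈0 i i<n∸m = tail≈0 (m ℕ.+ i) (ℕP.m≤m+n m i)
      (≡.subst (m ℕ.+ i <_) (ℕP.m+[n∸m]≡n m≤n) (ℕP.+-monoʳ-< m i<n∸m))

  Σ<-select : ∀ {n ρ} (f : ℕ → Carrier) → ρ < n → Σ< n (λ r → indicator (r ≡ᵇ ρ) * f r) ≈ f ρ
  Σ<-select {suc n} {zero} f _ = begin
    1# * f 0 + Σ< n (λ r → 0# * f (suc r)) ≈⟨ +-cong (*-identityˡ _) (Σ<-zero n (λ r _ → zeroˡ (f (suc r)))) ⟩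
    f 0 + 0#                               ≈⟨ +-identityʳ _ ⟩
    f 0                                    ∎
  Σ<-select {suc n} {suc ρ} f (s≤s ρ<n) = begin
    0# * f 0 + Σ< n (λ r → indicator (r ≡ᵇ ρ) * f (suc r)) ≈⟨ +-cong (zeroˡ _) (Σ<-select (f ∘ suc) ρ<n) ⟩
    0# + f (suc ρ)                                         ≈⟨ +-identityˡ _ ⟩
    f (suc ρ)                                              ∎

  ∑-select : ∀ {n} (y : Fin n) (f : Fin n → Carrier) → ∑[ x < n ] (indicator (does (y F.≟ x)) * f x) ≈ f y
  ∑-select {suc n} zero    f = begin
    1# * f zero + ∑[ x < n ] (0# * f (suc x))
      ≈⟨ +-cong (*-identityˡ _) (trans (sum-cong-≋ (λ x → zeroˡ (f (suc x)))) (sum-replicate-zero n)) ⟩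
    f zero + 0#
      ≈⟨ +-identityʳ _ ⟩
    f zero
      ∎
  ∑-select {suc n} (suc y) f = begin
    0# * f zero + ∑[ x < n ] (indicator (does (y F.≟ x)) * f (suc x)) ≈⟨ +-cong (zeroˡ _) (∑-select y (f ∘ suc)) ⟩
    0# + f (suc y)                                                    ≈⟨ +-identityˡ _ ⟩
    f (suc y)                                                         ∎

  Σ<-exchange : ∀ {n ρ} (f g : ℕ → Carrier) → ρ < n → (∀ r → r ≢ ρ → f r ≈ g r) →
    Σ< n f + g ρ ≈ Σ< n g + f ρ
  Σ<-exchange {suc n} {zero} f g _ f≈g = begin
    (f 0 + Σ< n (f ∘ suc)) + g 0 ≈⟨ +-congʳ (+-congˡ (Σ<-cong n (λ r _ → f≈g (suc r) λ ()))) ⟩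
    (f 0 + Σ< n (g ∘ suc)) + g 0 ≈⟨ xy∙z≈zy∙x (f 0) _ (g 0) ⟩
    (g 0 + Σ< n (g ∘ suc)) + f 0 ∎
  Σ<-exchange {suc n} {suc ρ} f g (s≤s ρ<n) f≈g = begin
    (f 0 + Σ< n (f ∘ suc)) + g (suc ρ) ≈⟨ +-assoc _ _ _ ⟩
    f 0 + (Σ< n (f ∘ suc) + g (suc ρ)) ≈⟨ +-cong (f≈g 0 λ ()) (Σ<-exchange _ _ ρ<n f′≈g′) ⟩
    g 0 + (Σ< n (g ∘ suc) + f (suc ρ)) ≈⟨ +-assoc _ _ _ ⟨
    (g 0 + Σ< n (g ∘ suc)) + f (suc ρ) ∎
    where
    f′≈g′ : ∀ r → r ≢ ρ → f (suc r) ≈ g (suc r)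
    f′≈g′ r r≢ρ = f≈g (suc r) (r≢ρ ∘ ℕP.suc-injective)

  shift-cong : ∀ {f g : ℕ → Carrier} → (∀ j → f j ≈ g j) → ∀ j → shift f j ≈ shift g j
  shift-cong f≈g zero    = refl
  shift-cong f≈g (suc j) = f≈g j

  shift-*ʳ : ∀ (g : ℕ → Carrier) x j → shift g j * x ≈ shift (λ j′ → g j′ * x) j
  shift-*ʳ g x zero    = zeroˡ x
  shift-*ʳ g x (suc j) = refl

  shift-Σ< : ∀ n (g : ℕ → ℕ → Carrier) j →
    Σ< n (λ i → shift (g i) j) ≈ shift (λ j′ → Σ< n (λ i → g i j′)) j
  shift-Σ< n g zero    = Σ<-zero n (λ _ _ → refl)
  shift-Σ< n g (suc j) = refl

module ℕΣ = RangeSum ℕP.+-*-commutativeSemiring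

module Counting where

  open import Data.Bool using (Bool; true; false; _∧_)
  open import Data.Fin using (Fin; zero; suc)
  open import Data.List using (List; []; _∷_; _++_; map; concatMap; tabulate; allFin)
  open import Data.Nat using (zero; suc; _+_; _*_)
  open import Data.Vec using (Vec; _∷_)
  open import Function using (_∘_; id)
  open import Relation.Binary.PropositionalEquality
  open import Defs using (count; allVecs)
  open ℕΣ

  module _ {A : Set} where

    count-cong : {p q : A → Bool} → (∀ x → p x ≡ q x) → ∀ xs → count p xs ≡ count q xs
    count-cong p≡q []       = refl
    count-cong {p} {q} p≡q (x ∷ xs) rewrite p≡q x with q x
    ... | true  = cong suc (count-cong p≡q xs)
    ... | false = count-cong p≡q xs

    count-none : (p : A → Bool) → (∀ x → p x ≡ false) → ∀ xs → count p xs ≡ 0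
    count-none p p≡false []       = refl
    count-none p p≡false (x ∷ xs) rewrite p≡false x = count-none p p≡false xs

    count-∧ˡ : ∀ b (p : A → Bool) xs → count (λ x → b ∧ p x) xs ≡ indicator b * count p xs
    count-∧ˡ true  p xs = sym (ℕP.+-identityʳ _)
    count-∧ˡ false p xs = count-none _ (λ _ → refl) xs

    count-++ : (p : A → Bool) (xs ys : List A) → count p (xs ++ ys) ≡ count p xs + count p ys
    count-++ p []       ys = refl
    count-++ p (x ∷ xs) ys with p x
    ... | true  = cong suc (count-++ p xs ys)
    ... | false = count-++ p xs ys

  module _ {A B : Set} where

    count-map : (p : B → Bool) (f : A → B) (xs : List A) → count p (map f xs) ≡ count (p ∘ f) xs
    count-map p f []       = refl
    count-map p f (x ∷ xs) with p (f x)
    ... | true  = cong suc (count-map p f xs)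
    ... | false = count-map p f xs

    count-concatMap-tabulate : ∀ {n} (p : B → Bool) (f : A → List B) (g : Fin n → A) →
      count p (concatMap f (tabulate g)) ≡ ∑[ x < n ] count p (f (g x))
    count-concatMap-tabulate {zero}  p f g = refl
    count-concatMap-tabulate {suc n} p f g = trans (count-++ p (f (g zero)) _)
      (cong (count p (f (g zero)) +_) (count-concatMap-tabulate p f (g ∘ suc)))

  count-tabulate : ∀ {m n} (p : Fin n → Bool) (g : Fin m → Fin n) →
    count p (tabulate g) ≡ ∑[ x < m ] indicator (p (g x))
  count-tabulate {zero}  p g = refl
  count-tabulate {suc m} p g with p (g zero)
  ... | true  = cong suc (count-tabulate p (g ∘ suc))
  ... | false = count-tabulate p (g ∘ suc)

  count-allFin : ∀ {n} (p : Fin n → Bool) → count p (allFin n) ≡ ∑[ x < n ] indicator (p x)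
  count-allFin p = count-tabulate p id

  count-allVecs-suc : ∀ n k (p : Vec (Fin n) (suc k) → Bool) →
    count p (allVecs n (suc k)) ≡ ∑[ x < n ] count (p ∘ (x ∷_)) (allVecs n k)
  count-allVecs-suc n k p = trans (count-concatMap-tabulate p (λ x → map (x ∷_) (allVecs n k)) id)
    (sum-cong-≗ (λ x → count-map p (x ∷_) (allVecs n k)))

module BooleanComparisons where

  open import Data.Bool using (true; false)
  open import Data.Nat using (_<_; _≤_; _<ᵇ_)
  open import Data.Nat.Properties using (_<?_)
  open import Function.Bundles using (mk⇔)
  open import Relation.Binary.PropositionalEquality using (_≡_)
  open import Relation.Nullary.Decidable using (does-⇔; dec-true; dec-false)

  <ᵇ≡<ᵇ : ∀ {m n m′ n′} → (m < n → m′ < n′) → (m′ < n′ → m < n) → (m <ᵇ n) ≡ (m′ <ᵇ n′)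
  <ᵇ≡<ᵇ {m} {n} {m′} {n′} to from = does-⇔ (mk⇔ to from) (m <? n) (m′ <? n′)

  <ᵇ-true : ∀ {m n} → m < n → (m <ᵇ n) ≡ true
  <ᵇ-true {m} {n} = dec-true (m <? n)

  <ᵇ-false : ∀ {m n} → n ≤ m → (m <ᵇ n) ≡ false
  <ᵇ-false {m} {n} n≤m = dec-false (m <? n) (ℕP.≤⇒≯ n≤m)

module FreeLetters where

  open import Data.Bool using (Bool; true; false; _∨_; not; if_then_else_)
  open import Data.Bool.Properties using (∨-identityʳ)
  open import Data.Empty using (⊥-elim)
  open import Data.Fin using (Fin; zero; suc; toℕ; _≟_)
  open import Data.Fin.Properties using (toℕ-injective)
  open import Data.Nat using (zero; suc; _+_; _<_; _≤_; z≤n; s≤s; _<ᵇ_)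
  open import Data.Product using (_×_; _,_)
  open import Function using (_∘_)
  open import Relation.Binary.Definitions using (tri<; tri≈; tri>)
  open import Relation.Binary.PropositionalEquality
  open import Relation.Nullary using (does; yes; no)
  open ℕΣ
  open BooleanComparisons

  ∅ : ∀ {M} → Fin M → Bool
  ∅ _ = false

  insert : ∀ {M} → Fin M → (Fin M → Bool) → Fin M → Bool
  insert y used z = used z ∨ does (y ≟ z)

  freeRank : ∀ {M} → (Fin M → Bool) → Fin M → ℕ
  freeRank used zero    = 0
  freeRank used (suc z) = indicator (not (used zero)) + freeRank (used ∘ suc) z

  freeCount : ∀ {M} → (Fin M → Bool) → ℕ
  freeCount {zero}  used = 0
  freeCount {suc M} used = indicator (not (used zero)) + freeCount (used ∘ suc)

  freeRank-∅ : ∀ {M} (y : Fin M) → freeRank ∅ y ≡ toℕ y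
  freeRank-∅ zero    = refl
  freeRank-∅ (suc y) = cong suc (freeRank-∅ y)

  freeCount-∅ : ∀ M → freeCount {M} ∅ ≡ M
  freeCount-∅ zero    = refl
  freeCount-∅ (suc M) = cong suc (freeCount-∅ M)

  freeRank-cong : ∀ {M} {used used′ : Fin M → Bool} → (∀ z → used z ≡ used′ z) →
    ∀ z → freeRank used z ≡ freeRank used′ z
  freeRank-cong eq zero    = refl
  freeRank-cong eq (suc z) = cong₂ (λ b r → indicator (not b) + r) (eq zero) (freeRank-cong (eq ∘ suc) z)

  freeCount-cong : ∀ {M} {used used′ : Fin M → Bool} → (∀ z → used z ≡ used′ z) →
    freeCount used ≡ freeCount used′
  freeCount-cong {zero}  eq = refl
  freeCount-cong {suc M} eq = cong₂ (λ b r → indicator (not b) + r) (eq zero) (freeCount-cong (eq ∘ suc))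

  ∑-free≡Σ<-freeCount : ∀ {M} (used : Fin M → Bool) (h : ℕ → ℕ) →
    ∑[ z < M ] (if used z then 0 else h (freeRank used z)) ≡ Σ< (freeCount used) h
  ∑-free≡Σ<-freeCount {zero}  used h = refl
  ∑-free≡Σ<-freeCount {suc M} used h with used zero
  ... | true  = ∑-free≡Σ<-freeCount (used ∘ suc) h
  ... | false = cong (h 0 +_) (∑-free≡Σ<-freeCount (used ∘ suc) (h ∘ suc))

  freeCount-insert : ∀ {M} (used : Fin M → Bool) y → used y ≡ false →
    freeCount used ≡ suc (freeCount (insert y used))
  freeCount-insert {suc M} used zero    y-free rewrite y-free =
    cong suc (freeCount-cong (λ z → sym (∨-identityʳ (used (suc z)))))
  freeCount-insert {suc M} used (suc y) y-free = begin
    indicator (not (used zero)) + freeCount (used ∘ suc)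
      ≡⟨ cong (indicator (not (used zero)) +_) (freeCount-insert (used ∘ suc) y y-free) ⟩
    indicator (not (used zero)) + suc (freeCount (insert y (used ∘ suc)))
      ≡⟨ ℕP.+-suc _ _ ⟩
    suc (indicator (not (used zero)) + freeCount (insert y (used ∘ suc)))
      ≡⟨ cong (λ b → suc (indicator (not b) + freeCount (insert y (used ∘ suc)))) (∨-identityʳ (used zero)) ⟨
    suc (freeCount (insert (suc y) used))
      ∎
    where open ≡-Reasoning

  freeRank-mono : ∀ {M} (used : Fin M → Bool) z y → toℕ z < toℕ y → used z ≡ false →
    freeRank used z < freeRank used y
  freeRank-mono used zero    (suc y) _         z-free rewrite z-free = s≤s z≤n
  freeRank-mono used (suc z) (suc y) (s≤s z<y) z-free =
    ℕP.+-monoʳ-< (indicator (not (used zero))) (freeRank-mono (used ∘ suc) z y z<y z-free)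

  freeRank-insert-≤ : ∀ {M} (used : Fin M → Bool) z y → toℕ z ≤ toℕ y →
    freeRank (insert y used) z ≡ freeRank used z
  freeRank-insert-≤ used zero    y       _         = refl
  freeRank-insert-≤ used (suc z) (suc y) (s≤s z≤y) =
    cong₂ (λ b r → indicator (not b) + r) (∨-identityʳ (used zero)) (freeRank-insert-≤ (used ∘ suc) z y z≤y)

  freeRank-insert-> : ∀ {M} (used : Fin M → Bool) z y → toℕ y < toℕ z → used y ≡ false →
    suc (freeRank (insert y used) z) ≡ freeRank used z
  freeRank-insert-> used (suc z) zero    _         y-free rewrite y-free =
    cong suc (freeRank-cong (λ u → ∨-identityʳ (used (suc u))) z)
  freeRank-insert-> used (suc z) (suc y) (s≤s y<z) y-free = begin
    suc (indicator (not (used zero ∨ false)) + freeRank (insert y (used ∘ suc)) z)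
      ≡⟨ cong (λ b → suc (indicator (not b) + freeRank (insert y (used ∘ suc)) z)) (∨-identityʳ (used zero)) ⟩
    suc (indicator (not (used zero)) + freeRank (insert y (used ∘ suc)) z)
      ≡⟨ ℕP.+-suc _ _ ⟨
    indicator (not (used zero)) + suc (freeRank (insert y (used ∘ suc)) z)
      ≡⟨ cong (indicator (not (used zero)) +_) (freeRank-insert-> (used ∘ suc) z y y<z y-free) ⟩
    freeRank used (suc z)
      ∎
    where open ≡-Reasoning

  insert-free : ∀ {M} (used : Fin M → Bool) y z → insert y used z ≡ false → used z ≡ false × y ≢ z
  insert-free used y z z-free with used z | y ≟ z
  insert-free used y z () | true  | _
  insert-free used y z () | false | yes _
  ... | false | no y≢z = refl , y≢z

  freeRank-order : ∀ {M} (used : Fin M → Bool) y z → used y ≡ false → insert y used z ≡ false →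
    (toℕ z <ᵇ toℕ y) ≡ (freeRank (insert y used) z <ᵇ freeRank used y)
  freeRank-order used y z y-free z-free′ with insert-free used y z z-free′
  ... | z-free , y≢z = <ᵇ≡<ᵇ to from
    where
    to : toℕ z < toℕ y → freeRank (insert y used) z < freeRank used y
    to z<y = subst (_< freeRank used y) (sym (freeRank-insert-≤ used z y (ℕP.<⇒≤ z<y)))
                   (freeRank-mono used z y z<y z-free)
    from : freeRank (insert y used) z < freeRank used y → toℕ z < toℕ y
    from r′<r with ℕP.<-cmp (toℕ z) (toℕ y)
    ... | tri< z<y _ _ = z<y
    ... | tri≈ _ z≡y _ = ⊥-elim (y≢z (sym (toℕ-injective z≡y)))
    ... | tri> _ _ y<z = ⊥-elim (ℕP.<⇒≱ r′<r (ℕP.≤-pred (subst (suc (freeRank used y) ≤_)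
                           (sym (freeRank-insert-> used z y y<z y-free)) (freeRank-mono used y z y<z y-free))))

module Permutations where

  open import Algebra.Bundles using (CommutativeMonoid)
  open import Data.Bool using (Bool; true; false; _∧_; not; if_then_else_)
  open import Data.Bool.Properties using (∧-assoc; ∧-zeroʳ; ∧-identityʳ; ∧-commutativeMonoid)
  open import Algebra.Properties.CommutativeSemigroup (CommutativeMonoid.commutativeSemigroup ∧-commutativeMonoid)
    using (x∙yz≈y∙xz)
  open import Data.Fin using (Fin; zero; suc; toℕ; _≟_)
  open import Data.Nat using (zero; suc; _+_; _*_; _<_; _≤_; s≤s; _≡ᵇ_; _<ᵇ_) renaming (_≟_ to _≟ℕ_)
  open import Data.List using (List)
  open import Data.Vec using (Vec; []; _∷_)
  open import Function using (_∘_)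
  open import Relation.Binary.PropositionalEquality
  open import Relation.Nullary using (yes; no)
  open import Relation.Nullary.Decidable using (⌊_⌋; isYes≗does)
  open import Defs using (A; allVecs; count; distinct?; des)
  open ℕΣ
  open Counting
  open BooleanComparisons
  open FreeLetters

  shiftIf : Bool → (ℕ → ℕ) → ℕ → ℕ
  shiftIf b g = if b then shift g else g

  shiftIf-cong : ∀ b {g g′ : ℕ → ℕ} → (∀ e → g e ≡ g′ e) → ∀ e → shiftIf b g e ≡ shiftIf b g′ e
  shiftIf-cong false g≗g′ e       = g≗g′ e
  shiftIf-cong true  g≗g′ zero    = refl
  shiftIf-cong true  g≗g′ (suc e) = g≗g′ e

  -- refinedEulerian m ρ e counts the permutations of [m] with e descents whose first letter
  -- is the (ρ+1)-st smallest; the recursion is on the relative rank r of the second letter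
  -- among the remaining ones, which gives a descent iff r < ρ.
  refinedEulerian : ℕ → ℕ → ℕ → ℕ
  refinedEulerian zero          ρ e = 0
  refinedEulerian (suc zero)    ρ e = indicator (0 ≡ᵇ e)
  refinedEulerian (suc (suc m)) ρ e = Σ< (suc m) (λ r → shiftIf (r <ᵇ ρ) (refinedEulerian (suc m) r) e)

  refinedEulerian-step : ∀ m r j → r ≤ m →
    refinedEulerian (suc (suc m)) r j + shift (refinedEulerian (suc m) r) j ≡
    refinedEulerian (suc (suc m)) (suc r) j + refinedEulerian (suc m) r j
  refinedEulerian-step m r j r≤m = begin
    refinedEulerian (suc (suc m)) r j + shift (refinedEulerian (suc m) r) j
      ≡⟨ cong (λ b → refinedEulerian (suc (suc m)) r j + shiftIf b (refinedEulerian (suc m) r) j)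
              (<ᵇ-true (ℕP.n<1+n r)) ⟨
    refinedEulerian (suc (suc m)) r j + term (suc r) r
      ≡⟨ Σ<-exchange (term r) (term (suc r)) (s≤s r≤m) agree ⟩
    refinedEulerian (suc (suc m)) (suc r) j + term r r
      ≡⟨ cong (λ b → refinedEulerian (suc (suc m)) (suc r) j + shiftIf b (refinedEulerian (suc m) r) j)
              (<ᵇ-false (ℕP.≤-refl {r})) ⟩
    refinedEulerian (suc (suc m)) (suc r) j + refinedEulerian (suc m) r j
      ∎
    where
    open ≡-Reasoning
    term : ℕ → ℕ → ℕ
    term ρ r′ = shiftIf (r′ <ᵇ ρ) (refinedEulerian (suc m) r′) j
    agree : ∀ r′ → r′ ≢ r → term r r′ ≡ term (suc r) r′
    agree r′ r′≢r = cong (λ b → shiftIf b (refinedEulerian (suc m) r′) j)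
      (<ᵇ≡<ᵇ ℕP.m<n⇒m<1+n (λ r′<1+r → ℕP.≤∧≢⇒< (ℕP.≤-pred r′<1+r) r′≢r))

  refinedEulerian-last : ∀ m j →
    refinedEulerian (suc (suc m)) (suc m) j ≡ Σ< (suc m) (λ r → shift (refinedEulerian (suc m) r) j)
  refinedEulerian-last m j = Σ<-cong (suc m) (λ r r<1+m →
    cong (λ b → shiftIf b (refinedEulerian (suc m) r) j) (<ᵇ-true r<1+m))

  _∉?_ : ∀ {M k} → Fin M → Vec (Fin M) k → Bool
  x ∉? []      = true
  x ∉? (y ∷ w) = not ⌊ x ≟ y ⌋ ∧ (x ∉? w)

  avoids? : ∀ {M k} → (Fin M → Bool) → Vec (Fin M) k → Bool
  avoids? used []      = true
  avoids? used (x ∷ w) = not (used x) ∧ avoids? used w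

  fresh? : ∀ {M k} → (Fin M → Bool) → Vec (Fin M) k → Bool
  fresh? used []      = true
  fresh? used (x ∷ w) = not (used x) ∧ fresh? (insert x used) w

  distinct?-∷ : ∀ {M k} (x : Fin M) (w : Vec (Fin M) k) → distinct? (x ∷ w) ≡ (x ∉? w) ∧ distinct? w
  distinct?-∷ x []      = refl
  distinct?-∷ x (y ∷ w) = under (not ⌊ x ≟ y ⌋) (distinct?-∷ x w)
    where
    under : ∀ a {p q r d} → p ∧ d ≡ q ∧ d → (a ∧ p) ∧ (r ∧ d) ≡ (a ∧ q) ∧ (r ∧ d)
    under a {r = r} {false} _ rewrite ∧-zeroʳ r = trans (∧-zeroʳ _) (sym (∧-zeroʳ _))
    under a {p} {q} {r} {true} p∧true≡q∧true =
      cong (λ b → (a ∧ b) ∧ (r ∧ true)) (trans (sym (∧-identityʳ p)) (trans p∧true≡q∧true (∧-identityʳ q)))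

  avoids?-insert : ∀ {M k} (used : Fin M → Bool) y (w : Vec (Fin M) k) →
    avoids? (insert y used) w ≡ avoids? used w ∧ (y ∉? w)
  avoids?-insert used y []      = refl
  avoids?-insert used y (x ∷ w) rewrite avoids?-insert used y w with used x | y ≟ x
  ... | true  | _     = refl
  ... | false | yes _ = sym (∧-zeroʳ _)
  ... | false | no _  = refl

  fresh?≡avoids?∧distinct? : ∀ {M k} (used : Fin M → Bool) (w : Vec (Fin M) k) →
    fresh? used w ≡ avoids? used w ∧ distinct? w
  fresh?≡avoids?∧distinct? used []      = refl
  fresh?≡avoids?∧distinct? used (x ∷ w) = begin
    not (used x) ∧ fresh? (insert x used) w
      ≡⟨ cong (not (used x) ∧_) (fresh?≡avoids?∧distinct? (insert x used) w) ⟩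
    not (used x) ∧ (avoids? (insert x used) w ∧ distinct? w)
      ≡⟨ cong (λ b → not (used x) ∧ (b ∧ distinct? w)) (avoids?-insert used x w) ⟩
    not (used x) ∧ ((avoids? used w ∧ (x ∉? w)) ∧ distinct? w)
      ≡⟨ cong (not (used x) ∧_) (∧-assoc (avoids? used w) (x ∉? w) (distinct? w)) ⟩
    not (used x) ∧ (avoids? used w ∧ ((x ∉? w) ∧ distinct? w))
      ≡⟨ ∧-assoc (not (used x)) (avoids? used w) ((x ∉? w) ∧ distinct? w) ⟨
    (not (used x) ∧ avoids? used w) ∧ ((x ∉? w) ∧ distinct? w)
      ≡⟨ cong (avoids? used (x ∷ w) ∧_) (distinct?-∷ x w) ⟨
    avoids? used (x ∷ w) ∧ distinct? (x ∷ w)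
      ∎
    where open ≡-Reasoning

  fresh?-∅ : ∀ {M k} (w : Vec (Fin M) k) → fresh? ∅ w ≡ distinct? w
  fresh?-∅ w = trans (fresh?≡avoids?∧distinct? ∅ w) (cong (_∧ distinct? w) (avoids?-∅ w))
    where
    avoids?-∅ : ∀ {M k} (w : Vec (Fin M) k) → avoids? ∅ w ≡ true
    avoids?-∅ []      = refl
    avoids?-∅ (x ∷ w) = avoids?-∅ w

  -- wordCount k used z b e counts the words z w₁ … w_k of pairwise distinct unused letters
  -- with e descents, counting one more if b (a descent into z).
  wordCount : ∀ {M} → ℕ → (Fin M → Bool) → Fin M → Bool → ℕ → ℕ
  wordCount {M} k used z b e =
    count (λ w → fresh? used (z ∷ w) ∧ ((if b then 1 else 0) + des (z ∷ w) ≡ᵇ e)) (allVecs M k)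

  module _ {M : ℕ} (k : ℕ) (used : Fin M → Bool) where

    wordCount-used : ∀ z b e → used z ≡ true → wordCount k used z b e ≡ 0
    wordCount-used z b e z-used = count-none _
      (λ w → cong (λ u → (not u ∧ fresh? (insert z used) w) ∧ ((if b then 1 else 0) + des (z ∷ w) ≡ᵇ e))
                  z-used)
      (allVecs M k)

    wordCount-descent : ∀ z b e → wordCount k used z b e ≡ shiftIf b (wordCount k used z false) e
    wordCount-descent z false e       = refl
    wordCount-descent z true  zero    = count-none _ (λ w → ∧-zeroʳ _) (allVecs M k)
    wordCount-descent z true  (suc e) = refl

    wordCount-suc : ∀ y e → wordCount (suc k) used y false e ≡
      indicator (not (used y)) * ∑[ z < M ] wordCount k (insert y used) z (toℕ z <ᵇ toℕ y) e
    wordCount-suc y e = begin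
      wordCount (suc k) used y false e
        ≡⟨ count-allVecs-suc M k _ ⟩
      ∑[ z < M ] count (λ w → (not (used y) ∧ fresh?′ z w) ∧ descents z w) words
        ≡⟨ sum-cong-≗ (λ z → count-cong (λ w → ∧-assoc (not (used y)) (fresh?′ z w) (descents z w)) words) ⟩
      ∑[ z < M ] count (λ w → not (used y) ∧ (fresh?′ z w ∧ descents z w)) words
        ≡⟨ sum-cong-≗ (λ z → count-∧ˡ (not (used y)) (λ w → fresh?′ z w ∧ descents z w) words) ⟩
      ∑[ z < M ] (indicator (not (used y)) * wordCount k (insert y used) z (toℕ z <ᵇ toℕ y) e)
        ≡⟨ *-distribˡ-sum (indicator (not (used y))) (λ z → wordCount k (insert y used) z (toℕ z <ᵇ toℕ y) e)
         ⟨
      indicator (not (used y)) * ∑[ z < M ] wordCount k (insert y used) z (toℕ z <ᵇ toℕ y) e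
        ∎
      where
      open ≡-Reasoning
      words : List (Vec (Fin M) k)
      words = allVecs M k
      fresh?′ : Fin M → Vec (Fin M) k → Bool
      fresh?′ z w = fresh? (insert y used) (z ∷ w)
      descents : Fin M → Vec (Fin M) k → Bool
      descents z w = (if toℕ z <ᵇ toℕ y then 1 else 0) + des (z ∷ w) ≡ᵇ e

  wordCount≡refinedEulerian : ∀ k {M} (used : Fin M → Bool) y → freeCount used ≡ suc k → used y ≡ false →
    ∀ e → wordCount k used y false e ≡ refinedEulerian (suc k) (freeRank used y) e
  wordCount≡refinedEulerian zero    used y _ y-free zero    rewrite y-free = refl
  wordCount≡refinedEulerian zero    used y _ y-free (suc e) rewrite y-free = refl
  wordCount≡refinedEulerian (suc k) {M} used y #free y-free e = begin
    wordCount (suc k) used y false e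
      ≡⟨ wordCount-suc k used y e ⟩
    indicator (not (used y)) * ∑[ z < M ] wordCount k used′ z (toℕ z <ᵇ toℕ y) e
      ≡⟨ cong (λ b → indicator (not b) * ∑[ z < M ] wordCount k used′ z (toℕ z <ᵇ toℕ y) e) y-free ⟩
    1 * ∑[ z < M ] wordCount k used′ z (toℕ z <ᵇ toℕ y) e
      ≡⟨ ℕP.*-identityˡ _ ⟩
    ∑[ z < M ] wordCount k used′ z (toℕ z <ᵇ toℕ y) e
      ≡⟨ sum-cong-≗ (λ z → term z (used′ z) refl) ⟩
    ∑[ z < M ] (if used′ z then 0 else h (freeRank used′ z))
      ≡⟨ ∑-free≡Σ<-freeCount used′ h ⟩
    Σ< (freeCount used′) h
      ≡⟨ cong (λ n → Σ< n h) #free′ ⟩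
    refinedEulerian (suc (suc k)) ρ e
      ∎
    where
    open ≡-Reasoning
    used′ : Fin M → Bool
    used′ = insert y used
    ρ : ℕ
    ρ = freeRank used y
    h : ℕ → ℕ
    h r = shiftIf (r <ᵇ ρ) (refinedEulerian (suc k) r) e
    #free′ : freeCount used′ ≡ suc k
    #free′ = ℕP.suc-injective (trans (sym (freeCount-insert used y y-free)) #free)
    term : ∀ z b → used′ z ≡ b →
      wordCount k used′ z (toℕ z <ᵇ toℕ y) e ≡ (if b then 0 else h (freeRank used′ z))
    term z true  z-used = wordCount-used k used′ z (toℕ z <ᵇ toℕ y) e z-used
    term z false z-free = begin
      wordCount k used′ z (toℕ z <ᵇ toℕ y) e
        ≡⟨ wordCount-descent k used′ z (toℕ z <ᵇ toℕ y) e ⟩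
      shiftIf (toℕ z <ᵇ toℕ y) (wordCount k used′ z false) e
        ≡⟨ cong (λ b → shiftIf b (wordCount k used′ z false) e) (freeRank-order used y z y-free z-free) ⟩
      shiftIf (freeRank used′ z <ᵇ ρ) (wordCount k used′ z false) e
        ≡⟨ shiftIf-cong (freeRank used′ z <ᵇ ρ) (wordCount≡refinedEulerian k used′ z #free′ z-free) e ⟩
      h (freeRank used′ z)
        ∎

  A≡refinedEulerian : ∀ m ρ j → ρ ≤ m → A (suc m) j (suc ρ) ≡ refinedEulerian (suc m) ρ j
  A≡refinedEulerian m ρ j ρ≤m = begin
    A (suc m) j (suc ρ)
      ≡⟨ count-allVecs-suc (suc m) m _ ⟩
    ∑[ y < suc m ] count (λ w → distinct? (y ∷ w) ∧ (⌊ suc (toℕ y) ≟ℕ suc ρ ⌋ ∧ ⌊ des (y ∷ w) ≟ℕ j ⌋)) words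
      ≡⟨ sum-cong-≗ (λ y → count-cong (predicate y) words) ⟩
    ∑[ y < suc m ] count (λ w → (toℕ y ≡ᵇ ρ) ∧ (fresh? ∅ (y ∷ w) ∧ (des (y ∷ w) ≡ᵇ j))) words
      ≡⟨ sum-cong-≗ (λ y → count-∧ˡ (toℕ y ≡ᵇ ρ) (λ w → fresh? ∅ (y ∷ w) ∧ (des (y ∷ w) ≡ᵇ j)) words) ⟩
    ∑[ y < suc m ] (indicator (toℕ y ≡ᵇ ρ) * wordCount m ∅ y false j)
      ≡⟨ sum-cong-≗ (λ y → cong (indicator (toℕ y ≡ᵇ ρ) *_)
           (trans (wordCount≡refinedEulerian m ∅ y (freeCount-∅ (suc m)) refl j)
                  (cong (λ r → refinedEulerian (suc m) r j) (freeRank-∅ y)))) ⟩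
    Σ< (suc m) (λ r → indicator (r ≡ᵇ ρ) * refinedEulerian (suc m) r j)
      ≡⟨ Σ<-select (λ r → refinedEulerian (suc m) r j) (s≤s ρ≤m) ⟩
    refinedEulerian (suc m) ρ j
      ∎
    where
    open ≡-Reasoning
    words : List (Vec (Fin (suc m)) m)
    words = allVecs (suc m) m
    predicate : ∀ y (w : Vec (Fin (suc m)) m) →
      distinct? (y ∷ w) ∧ (⌊ suc (toℕ y) ≟ℕ suc ρ ⌋ ∧ ⌊ des (y ∷ w) ≟ℕ j ⌋) ≡
      (toℕ y ≡ᵇ ρ) ∧ (fresh? ∅ (y ∷ w) ∧ (des (y ∷ w) ≡ᵇ j))
    predicate y w
      rewrite isYes≗does (suc (toℕ y) ≟ℕ suc ρ) | isYes≗does (des (y ∷ w) ≟ℕ j) | fresh?-∅ (y ∷ w)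
      = x∙yz≈y∙xz (distinct? (y ∷ w)) (toℕ y ≡ᵇ ρ) (des (y ∷ w) ≡ᵇ j)

module Walks {n : ℕ} (step : Fin n → Fin n → ℕ) where

  open import Data.Nat using (zero; suc; _*_)
  open import Relation.Binary.PropositionalEquality
  open ℕΣ

  walksFrom : (Fin n → ℕ) → ℕ → Fin n → ℕ
  walksFrom w zero    x = w x
  walksFrom w (suc k) x = ∑[ y < n ] (step x y * walksFrom w k y)

  walksTo : (Fin n → ℕ) → ℕ → Fin n → ℕ
  walksTo u zero    a = u a
  walksTo u (suc k) a = ∑[ x < n ] (walksTo u k x * step x a)

  walksTo-suc : ∀ k u a → walksTo (λ y → ∑[ x < n ] (u x * step x y)) k a ≡ walksTo u (suc k) a
  walksTo-suc zero    u a = refl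
  walksTo-suc (suc k) u a = sum-cong-≗ (λ x → cong (_* step x a) (walksTo-suc k u x))

  ∑-walksFrom≡∑-walksTo : ∀ k u w → ∑[ x < n ] (u x * walksFrom w k x) ≡ ∑[ a < n ] (walksTo u k a * w a)
  ∑-walksFrom≡∑-walksTo zero    u w = refl
  ∑-walksFrom≡∑-walksTo (suc k) u w = begin
    ∑[ x < n ] (u x * ∑[ y < n ] (step x y * walksFrom w k y))
      ≡⟨ sum-cong-≗ (λ x → *-distribˡ-sum (u x) (λ y → step x y * walksFrom w k y)) ⟩
    ∑[ x < n ] ∑[ y < n ] (u x * (step x y * walksFrom w k y))
      ≡⟨ ∑-comm (λ x y → u x * (step x y * walksFrom w k y)) ⟩
    ∑[ y < n ] ∑[ x < n ] (u x * (step x y * walksFrom w k y))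
      ≡⟨ sum-cong-≗ (λ y → sum-cong-≗ (λ x → sym (ℕP.*-assoc (u x) (step x y) (walksFrom w k y)))) ⟩
    ∑[ y < n ] ∑[ x < n ] (u x * step x y * walksFrom w k y)
      ≡⟨ sum-cong-≗ (λ y → sym (*-distribʳ-sum (walksFrom w k y) (λ x → u x * step x y))) ⟩
    ∑[ y < n ] (∑[ x < n ] (u x * step x y) * walksFrom w k y)
      ≡⟨ ∑-walksFrom≡∑-walksTo k (λ y → ∑[ x < n ] (u x * step x y)) w ⟩
    ∑[ a < n ] (walksTo (λ y → ∑[ x < n ] (u x * step x y)) k a * w a)
      ≡⟨ sum-cong-≗ (λ a → cong (_* w a) (walksTo-suc k u a)) ⟩
    ∑[ a < n ] (walksTo u (suc k) a * w a)
      ∎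
    where open ≡-Reasoning

module SubsetSum where

  open import Algebra.Properties.CommutativeSemigroup ℕP.+-commutativeSemigroup using (x∙yz≈y∙xz)
  open import Data.Bool using (true; false)
  open import Data.Fin.Subset using (Subset; ∣_∣)
  open import Data.Fin.Subset.Properties using (_⊆?_)
  open import Data.Nat using (zero; suc; _+_; _*_; _^_)
  open import Data.Nat.Combinatorics using (_C_; nCk+nC[k+1]≡[n+1]C[k+1]; k>n⇒nCk≡0)
  open import Data.Vec using ([]; _∷_)
  open import Data.Vec.Properties using (∷-injectiveʳ)
  open import Function using (_∘_)
  open import Relation.Binary.PropositionalEquality
  open import Relation.Nullary using (does)
  open ℕΣ

  subsetSum : (r : ℕ) → (Subset r → ℕ) → ℕ
  subsetSum zero    g = g []
  subsetSum (suc r) g = subsetSum r (g ∘ (true ∷_)) + subsetSum r (g ∘ (false ∷_))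

  subsetSum-cong : ∀ r {f g : Subset r → ℕ} → (∀ T → f T ≡ g T) → subsetSum r f ≡ subsetSum r g
  subsetSum-cong zero    f≗g = f≗g []
  subsetSum-cong (suc r) f≗g =
    cong₂ _+_ (subsetSum-cong r (f≗g ∘ (true ∷_))) (subsetSum-cong r (f≗g ∘ (false ∷_)))

  subsetSum-zero : ∀ r {g : Subset r → ℕ} → (∀ T → g T ≡ 0) → subsetSum r g ≡ 0
  subsetSum-zero zero    g≗0 = g≗0 []
  subsetSum-zero (suc r) g≗0 =
    cong₂ _+_ (subsetSum-zero r (g≗0 ∘ (true ∷_))) (subsetSum-zero r (g≗0 ∘ (false ∷_)))

  subsetSum-select : ∀ {r} S (g : Subset r → ℕ) → (∀ T → T ≢ S → g T ≡ 0) → subsetSum r g ≡ g S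
  subsetSum-select []          g _   = refl
  subsetSum-select (true ∷ S)  g g≡0 = trans
    (cong₂ _+_ (subsetSum-select S (g ∘ (true ∷_)) (λ T T≢S → g≡0 (true ∷ T) (T≢S ∘ ∷-injectiveʳ)))
               (subsetSum-zero _ (λ T → g≡0 (false ∷ T) λ ())))
    (ℕP.+-identityʳ _)
  subsetSum-select (false ∷ S) g g≡0 =
    cong₂ _+_ (subsetSum-zero _ (λ T → g≡0 (true ∷ T) λ ()))
              (subsetSum-select S (g ∘ (false ∷_)) (λ T T≢S → g≡0 (false ∷ T) (T≢S ∘ ∷-injectiveʳ)))

  *-distribʳ-subsetSum : ∀ r (g : Subset r → ℕ) c → subsetSum r g * c ≡ subsetSum r (λ T → g T * c)
  *-distribʳ-subsetSum zero    g c = refl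
  *-distribʳ-subsetSum (suc r) g c =
    trans (ℕP.*-distribʳ-+ c (subsetSum r (g ∘ (true ∷_))) (subsetSum r (g ∘ (false ∷_))))
          (cong₂ _+_ (*-distribʳ-subsetSum r (g ∘ (true ∷_)) c) (*-distribʳ-subsetSum r (g ∘ (false ∷_)) c))

  ∑-subsetSum-comm : ∀ {n} r (f : Fin n → Subset r → ℕ) →
    ∑[ x < n ] subsetSum r (f x) ≡ subsetSum r (λ T → ∑[ x < n ] f x T)
  ∑-subsetSum-comm zero    f = refl
  ∑-subsetSum-comm (suc r) f =
    trans (∑-distrib-+ (λ x → subsetSum r (f x ∘ (true ∷_))) (λ x → subsetSum r (f x ∘ (false ∷_))))
          (cong₂ _+_ (∑-subsetSum-comm r (λ x → f x ∘ (true ∷_))) (∑-subsetSum-comm r (λ x → f x ∘ (false ∷_))))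

  subsetSum-1 : ∀ r → subsetSum r (λ _ → 1) ≡ 2 ^ r
  subsetSum-1 zero    = refl
  subsetSum-1 (suc r) =
    trans (cong₂ _+_ (subsetSum-1 r) (subsetSum-1 r)) (cong (2 ^ r +_) (sym (ℕP.+-identityʳ (2 ^ r))))

  subsetSum-⊆ : ∀ {r} (T : Subset r) → subsetSum r (λ T′ → indicator (does (T′ ⊆? T))) ≡ 2 ^ ∣ T ∣
  subsetSum-⊆ []                  = refl
  subsetSum-⊆ (true ∷ T)          =
    trans (cong₂ _+_ (subsetSum-⊆ T) (subsetSum-⊆ T)) (cong (2 ^ ∣ T ∣ +_) (sym (ℕP.+-identityʳ _)))
  subsetSum-⊆ {suc r} (false ∷ T) = cong₂ _+_ (subsetSum-zero r (λ _ → refl)) (subsetSum-⊆ T)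

  subsetSum-by-size : ∀ r (g : ℕ → ℕ) → subsetSum r (λ T → g ∣ T ∣) ≡ Σ< (suc r) (λ i → (r C i) * g i)
  subsetSum-by-size zero    g = sym (trans (ℕP.+-identityʳ _) (ℕP.*-identityˡ (g 0)))
  subsetSum-by-size (suc r) g = begin
    subsetSum r (λ T → g (suc ∣ T ∣)) + subsetSum r (λ T → g ∣ T ∣)
      ≡⟨ cong₂ _+_ (subsetSum-by-size r (g ∘ suc)) (subsetSum-by-size r g) ⟩
    containing + ((r C 0) * g 0 + Σ< r avoiding)
      ≡⟨ cong (λ s → containing + ((r C 0) * g 0 + s)) top-vanishes ⟨
    containing + ((r C 0) * g 0 + Σ< (suc r) avoiding)
      ≡⟨ x∙yz≈y∙xz containing ((r C 0) * g 0) (Σ< (suc r) avoiding) ⟩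
    (r C 0) * g 0 + (containing + Σ< (suc r) avoiding)
      ≡⟨ cong ((r C 0) * g 0 +_) (Σ<-distrib-+ (suc r) (λ i → (r C i) * g (suc i)) avoiding) ⟨
    (r C 0) * g 0 + Σ< (suc r) (λ i → (r C i) * g (suc i) + (r C suc i) * g (suc i))
      ≡⟨ cong ((r C 0) * g 0 +_) (Σ<-cong (suc r) (λ i _ → pascal i)) ⟩
    Σ< (suc (suc r)) (λ i → (suc r C i) * g i)
      ∎
    where
    open ≡-Reasoning
    containing : ℕ
    containing = Σ< (suc r) (λ i → (r C i) * g (suc i))
    avoiding : ℕ → ℕ
    avoiding i = (r C suc i) * g (suc i)
    top-vanishes : Σ< (suc r) avoiding ≡ Σ< r avoiding
    top-vanishes = trans (Σ<-last r avoiding)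
      (trans (cong (λ c → Σ< r avoiding + c * g (suc r)) (k>n⇒nCk≡0 (ℕP.n<1+n r))) (ℕP.+-identityʳ _))
    pascal : ∀ i → (r C i) * g (suc i) + (r C suc i) * g (suc i) ≡ (suc r C suc i) * g (suc i)
    pascal i = trans (sym (ℕP.*-distribʳ-+ (g (suc i)) (r C i) (r C suc i)))
                     (cong (_* g (suc i)) (nCk+nC[k+1]≡[n+1]C[k+1] r i))

module Surjections where

  open import Data.Bool using (not)
  open import Data.Fin.Subset using (∣_∣)
  open import Data.Nat using (zero; suc; _+_; _*_; _<_; _≡ᵇ_; s≤s) renaming (_≟_ to _≟ℕ_)
  open import Data.Nat.Combinatorics using (_C_)
  open import Relation.Binary.PropositionalEquality
  open import Relation.Nullary.Decidable using (dec-true; dec-false)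
  open ℕΣ
  open SubsetSum

  -- surjections u k counts the surjections [u] ↠ [k], equivalently the chains
  -- ∅ = T₀ ⊊ T₁ ⊊ ⋯ ⊊ T_k = [u]; the recursion is on the size i of T_{k-1}.
  surjections : ℕ → ℕ → ℕ
  surjections u zero    = indicator (u ≡ᵇ 0)
  surjections u (suc k) = Σ< u (λ i → (u C i) * surjections i k)

  surjections-vanish : ∀ {u k} → u < k → surjections u k ≡ 0
  surjections-vanish {u} {suc k} (s≤s u≤k) = Σ<-zero u (λ i i<u →
    trans (cong ((u C i) *_) (surjections-vanish (ℕP.<-≤-trans i<u u≤k))) (ℕP.*-zeroʳ (u C i)))

  surjections-1 : ∀ u → surjections u 1 ≡ indicator (not (u ≡ᵇ 0))
  surjections-1 zero    = refl
  surjections-1 (suc u) = cong (1 +_) (Σ<-zero u (λ i _ → ℕP.*-zeroʳ (suc u C suc i)))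

  subsetSum-proper-surjections : ∀ r k →
    subsetSum r (λ T → indicator (not (∣ T ∣ ≡ᵇ r)) * surjections ∣ T ∣ k) ≡ surjections r (suc k)
  subsetSum-proper-surjections r k = begin
    subsetSum r (λ T → proper ∣ T ∣)
      ≡⟨ subsetSum-by-size r proper ⟩
    Σ< (suc r) (λ i → (r C i) * proper i)
      ≡⟨ Σ<-truncate (λ i → (r C i) * proper i) (ℕP.n≤1+n r) (λ i r≤i i≤r →
           trans (cong (λ b → (r C i) * (indicator (not b) * surjections i k))
                       (dec-true (i ≟ℕ r) (ℕP.≤-antisym (ℕP.≤-pred i≤r) r≤i)))
                 (ℕP.*-zeroʳ (r C i))) ⟩
    Σ< r (λ i → (r C i) * proper i)
      ≡⟨ Σ<-cong r (λ i i<r → cong (λ b → (r C i) * (indicator (not b) * surjections i k))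
                                   (dec-false (i ≟ℕ r) (ℕP.<⇒≢ i<r))) ⟩
    Σ< r (λ i → (r C i) * (1 * surjections i k))
      ≡⟨ Σ<-cong r (λ i _ → cong ((r C i) *_) (ℕP.*-identityˡ (surjections i k))) ⟩
    surjections r (suc k)
      ∎
    where
    open ≡-Reasoning
    proper : ℕ → ℕ
    proper i = indicator (not (i ≡ᵇ r)) * surjections i k

module LowerIntervals {n : ℕ} (Δ : BooleanCellComplex n) where

  open import Data.Empty using (⊥-elim)
  open import Data.Fin using (_≟_)
  open import Data.Fin.Subset using (Subset; ⊥; ∣_∣; _⊆_)
  open import Data.Fin.Subset.Properties using (_⊆?_; ⊆-antisym; ∣⊥∣≡0; ∣p∣≡n⇒p≡⊤; ⊆⊤)
  open import Data.Nat using (_*_; _^_; _≡ᵇ_) renaming (_≟_ to _≟ℕ_)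
  open import Data.Nat.Logarithm using (⌊log₂_⌋; ⌊log₂[2^n]⌋≡n)
  open import Data.Product using (_,_; proj₂)
  open import Data.Vec using ([])
  open import Function using (_∘_)
  open import Function.Bundles using (Equivalence; mk⇔)
  open import Relation.Binary.PropositionalEquality
  open import Relation.Nullary using (does; yes; no)
  open import Relation.Nullary.Decidable using (does-⇔; dec-true; dec-false)
  open BooleanCellComplex Δ
  open ℕΣ
  open SubsetSum

  φ-injective : ∀ a {S T} → φ a S ≡ φ a T → S ≡ T
  φ-injective a {S} {T} φS≡φT =
    ⊆-antisym (Equivalence.from (φ-order a S T) (subst (φ a S ≼_) φS≡φT (≼-refl _)))
              (Equivalence.from (φ-order a T S) (subst (_≼ φ a S) φS≡φT (≼-refl _)))

  subsetSum-φ≟ : ∀ a x → subsetSum (rank a) (λ T → indicator (does (φ a T ≟ x))) ≡ indicator (does (x ≼? a))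
  subsetSum-φ≟ a x with x ≼? a
  ... | no x⋠a = subsetSum-zero (rank a) (λ T →
    cong indicator (dec-false (φ a T ≟ x) (λ φT≡x → x⋠a (subst (_≼ a) φT≡x (φ-below a T)))))
  ... | yes x≼a with φ-onto a x x≼a
  ...   | S , φS≡x = trans
    (subsetSum-select S _ (λ T T≢S →
      cong indicator (dec-false (φ a T ≟ x) (λ φT≡x → T≢S (φ-injective a (trans φT≡x (sym φS≡x)))))))
    (cong indicator (dec-true (φ a S ≟ x) φS≡x))

  ∑-below≡subsetSum : ∀ a (h : Fin n → ℕ) →
    ∑[ x < n ] (indicator (does (x ≼? a)) * h x) ≡ subsetSum (rank a) (h ∘ φ a)
  ∑-below≡subsetSum a h = begin
    ∑[ x < n ] (indicator (does (x ≼? a)) * h x)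
      ≡⟨ sum-cong-≗ (λ x → cong (_* h x) (subsetSum-φ≟ a x)) ⟨
    ∑[ x < n ] (subsetSum (rank a) (λ T → indicator (does (φ a T ≟ x))) * h x)
      ≡⟨ sum-cong-≗ (λ x → *-distribʳ-subsetSum (rank a) _ (h x)) ⟩
    ∑[ x < n ] subsetSum (rank a) (λ T → indicator (does (φ a T ≟ x)) * h x)
      ≡⟨ ∑-subsetSum-comm (rank a) (λ x T → indicator (does (φ a T ≟ x)) * h x) ⟩
    subsetSum (rank a) (λ T → ∑[ x < n ] (indicator (does (φ a T ≟ x)) * h x))
      ≡⟨ subsetSum-cong (rank a) (λ T → ∑-select (φ a T) h) ⟩
    subsetSum (rank a) (h ∘ φ a)
      ∎
    where open ≡-Reasoning

  -- the interval below φ a T has 2 ^ rank (φ a T) elements, and φ a identifies it with the subsets of T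
  rank-φ : ∀ a T → rank (φ a T) ≡ ∣ T ∣
  rank-φ a T = 2^-injective (begin
    2 ^ rank y
      ≡⟨ subsetSum-1 (rank y) ⟨
    subsetSum (rank y) (λ _ → 1)
      ≡⟨ ∑-below≡subsetSum y (λ _ → 1) ⟨
    ∑[ x < n ] (indicator (does (x ≼? y)) * 1)
      ≡⟨ sum-cong-≗ below-y ⟩
    ∑[ x < n ] (indicator (does (x ≼? a)) * indicator (does (x ≼? y)))
      ≡⟨ ∑-below≡subsetSum a (λ x → indicator (does (x ≼? y))) ⟩
    subsetSum (rank a) (λ T′ → indicator (does (φ a T′ ≼? y)))
      ≡⟨ subsetSum-cong (rank a) (λ T′ → cong indicator (does-⇔ (φ-order a T′ T) (T′ ⊆? T) (φ a T′ ≼? y))) ⟨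
    subsetSum (rank a) (λ T′ → indicator (does (T′ ⊆? T)))
      ≡⟨ subsetSum-⊆ T ⟩
    2 ^ ∣ T ∣
      ∎)
    where
    open ≡-Reasoning
    y : Fin n
    y = φ a T
    2^-injective : ∀ {p q} → 2 ^ p ≡ 2 ^ q → p ≡ q
    2^-injective {p} {q} eq = trans (sym (⌊log₂[2^n]⌋≡n p)) (trans (cong ⌊log₂_⌋ eq) (⌊log₂[2^n]⌋≡n q))
    below-y : ∀ x → indicator (does (x ≼? y)) * 1 ≡ indicator (does (x ≼? a)) * indicator (does (x ≼? y))
    below-y x with x ≼? y | x ≼? a
    ... | yes _   | yes _  = refl
    ... | yes x≼y | no x⋠a = ⊥-elim (x⋠a (≼-trans x≼y (φ-below a T)))
    ... | no _    | x≼?a   = sym (ℕP.*-zeroʳ (indicator (does x≼?a)))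

  φ-∅ : ∀ T → φ ∅ T ≡ ∅
  φ-∅ T = ≼-antisym (φ-below ∅ T) (∅-least _)

  rank-∅ : rank ∅ ≡ 0
  rank-∅ = trans (cong rank (sym (φ-∅ ⊥))) (trans (rank-φ ∅ ⊥) (∣⊥∣≡0 (rank ∅)))

  rank≡0⇒≡∅ : ∀ {x} → rank x ≡ 0 → x ≡ ∅
  rank≡0⇒≡∅ {x} rank≡0 = trans (sym (proj₂ (φ-onto x x (≼-refl x))))
    (trans (cong (φ x) (unique rank≡0 _ _)) (proj₂ (φ-onto x ∅ (∅-least x))))
    where
    unique : ∀ {r} → r ≡ 0 → (S S′ : Subset r) → S ≡ S′
    unique refl [] [] = refl

  rank≡ᵇ0 : ∀ a → (rank a ≡ᵇ 0) ≡ does (a ≟ ∅)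
  rank≡ᵇ0 a = does-⇔ (mk⇔ rank≡0⇒≡∅ (λ a≡∅ → trans (cong rank a≡∅) rank-∅)) (rank a ≟ℕ 0) (a ≟ ∅)

  φ≡top : ∀ a T → does (φ a T ≟ a) ≡ (∣ T ∣ ≡ᵇ rank a)
  φ≡top a T = does-⇔ (mk⇔ (λ φT≡a → trans (sym (rank-φ a T)) (cong rank φT≡a)) full⇒top)
                     (φ a T ≟ a) (∣ T ∣ ≟ℕ rank a)
    where
    full⇒top : ∣ T ∣ ≡ rank a → φ a T ≡ a
    full⇒top ∣T∣≡rank = ≼-antisym (φ-below a T)
      (subst (_≼ φ a T) (proj₂ (φ-onto a a (≼-refl a)))
        (Equivalence.to (φ-order a _ T) (subst (_ ⊆_) (sym (∣p∣≡n⇒p≡⊤ ∣T∣≡rank)) ⊆⊤)))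

module Chains {n : ℕ} (Δ : BooleanCellComplex n) where

  open import Data.Bool using (Bool; true; false; _∧_; not)
  open import Data.Bool.Properties using (∧-assoc)
  open import Data.Fin using (toℕ; _≟_)
  open import Data.Fin.Subset using (∣_∣)
  open import Data.Nat using (zero; suc; _*_; _≡ᵇ_; s≤s) renaming (_≟_ to _≟ℕ_)
  open import Data.Product using (_,_)
  open import Data.Vec using (Vec; _∷_)
  open import Function using (_∘_)
  open import Function.Bundles using (mk⇔)
  open import Relation.Binary.PropositionalEquality
  open import Relation.Nullary using (does; yes; no)
  open import Relation.Nullary.Decidable using (⌊_⌋; isYes≗does; does-⇔; dec-true)
  open import Defs using (IsDim; fΔ; fsd; chain?; count; allVecs)
  open BooleanCellComplex Δ
  open ℕΣ
  open Counting
  open SubsetSum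
  open Surjections
  open LowerIntervals Δ

  nonempty : Fin n → ℕ
  nonempty x = indicator (not (does (x ≟ ∅)))

  chainStep? : Fin n → Fin n → Bool
  chainStep? x y = not (does (x ≟ ∅)) ∧ (does (x ≼? y) ∧ not (does (x ≟ y)))

  open Walks (λ x y → indicator (chainStep? x y))

  chain?-∷∷ : ∀ {k} x y (w : Vec (Fin n) k) → chain? Δ (x ∷ y ∷ w) ≡ chainStep? x y ∧ chain? Δ (y ∷ w)
  chain?-∷∷ x y w rewrite isYes≗does (x ≟ ∅) | isYes≗does (x ≼? y) | isYes≗does (x ≟ y) =
    sym (trans (∧-assoc (not (does (x ≟ ∅))) (does (x ≼? y) ∧ not (does (x ≟ y))) (chain? Δ (y ∷ w)))
               (cong (not (does (x ≟ ∅)) ∧_) (∧-assoc (does (x ≼? y)) (not (does (x ≟ y))) (chain? Δ (y ∷ w)))))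

  chainsFrom≡walksFrom : ∀ k x → count (λ w → chain? Δ (x ∷ w)) (allVecs n k) ≡ walksFrom nonempty k x
  chainsFrom≡walksFrom zero    x rewrite isYes≗does (x ≟ ∅) with does (x ≟ ∅)
  ... | true  = refl
  ... | false = refl
  chainsFrom≡walksFrom (suc k) x = begin
    count (λ w → chain? Δ (x ∷ w)) (allVecs n (suc k))
      ≡⟨ count-allVecs-suc n k _ ⟩
    ∑[ y < n ] count (λ w → chain? Δ (x ∷ y ∷ w)) (allVecs n k)
      ≡⟨ sum-cong-≗ (λ y → count-cong (chain?-∷∷ x y) (allVecs n k)) ⟩
    ∑[ y < n ] count (λ w → chainStep? x y ∧ chain? Δ (y ∷ w)) (allVecs n k)
      ≡⟨ sum-cong-≗ (λ y → count-∧ˡ (chainStep? x y) _ (allVecs n k)) ⟩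
    ∑[ y < n ] (indicator (chainStep? x y) * count (λ w → chain? Δ (y ∷ w)) (allVecs n k))
      ≡⟨ sum-cong-≗ (λ y → cong (indicator (chainStep? x y) *_) (chainsFrom≡walksFrom k y)) ⟩
    walksFrom nonempty (suc k) x
      ∎
    where open ≡-Reasoning

  walksFrom-∅ : ∀ k → walksFrom nonempty k ∅ ≡ 0
  walksFrom-∅ zero    = cong (indicator ∘ not) (dec-true (∅ ≟ ∅) refl)
  walksFrom-∅ (suc k) = trans (sum-cong-≗ ∅-step) (sum-replicate-zero n)
    where
    ∅-step : ∀ y → indicator (chainStep? ∅ y) * walksFrom nonempty k y ≡ 0
    ∅-step y = cong (λ b → indicator (not b ∧ (does (∅ ≼? y) ∧ not (does (∅ ≟ y)))) * walksFrom nonempty k y)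
                    (dec-true (∅ ≟ ∅) refl)

  nonempty-*-walksFrom : ∀ k x → nonempty x * walksFrom nonempty k x ≡ walksFrom nonempty k x
  nonempty-*-walksFrom k x with x ≟ ∅
  ... | yes refl = sym (walksFrom-∅ k)
  ... | no _     = ℕP.+-identityʳ _

  surjections-*-nonempty : ∀ k x → surjections (rank x) (suc k) * nonempty x ≡ surjections (rank x) (suc k)
  surjections-*-nonempty k x with x ≟ ∅
  ... | yes refl = trans (cong (λ r → surjections r (suc k) * 0) rank-∅)
                         (cong (λ r → surjections r (suc k)) (sym rank-∅))
  ... | no _     = ℕP.*-identityʳ _

  walksTo≡surjections : ∀ k a → walksTo nonempty k a ≡ surjections (rank a) (suc k)
  walksTo≡surjections zero    a = sym (trans (surjections-1 (rank a)) (cong (indicator ∘ not) (rank≡ᵇ0 a)))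
  walksTo≡surjections (suc k) a = begin
    ∑[ x < n ] (walksTo nonempty k x * indicator (chainStep? x a))
      ≡⟨ sum-cong-≗ (λ x → cong (_* indicator (chainStep? x a)) (walksTo≡surjections k x)) ⟩
    ∑[ x < n ] (surjections (rank x) (suc k) * indicator (chainStep? x a))
      ≡⟨ sum-cong-≗ strictly-below ⟩
    ∑[ x < n ] (indicator (does (x ≼? a)) * (indicator (not (does (x ≟ a))) * surjections (rank x) (suc k)))
      ≡⟨ ∑-below≡subsetSum a (λ x → indicator (not (does (x ≟ a))) * surjections (rank x) (suc k)) ⟩
    subsetSum (rank a) (λ T → indicator (not (does (φ a T ≟ a))) * surjections (rank (φ a T)) (suc k))
      ≡⟨ subsetSum-cong (rank a) (λ T →
           cong₂ (λ b i → indicator (not b) * surjections i (suc k)) (φ≡top a T) (rank-φ a T)) ⟩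
    subsetSum (rank a) (λ T → indicator (not (∣ T ∣ ≡ᵇ rank a)) * surjections ∣ T ∣ (suc k))
      ≡⟨ subsetSum-proper-surjections (rank a) (suc k) ⟩
    surjections (rank a) (suc (suc k))
      ∎
    where
    open ≡-Reasoning
    strictly-below : ∀ x → surjections (rank x) (suc k) * indicator (chainStep? x a) ≡
                           indicator (does (x ≼? a)) * (indicator (not (does (x ≟ a))) * surjections (rank x) (suc k))
    strictly-below x = begin
      s * indicator (chainStep? x a)
        ≡⟨ cong (s *_) (trans (indicator-∧ (not (does (x ≟ ∅))) (does (x ≼? a) ∧ not (does (x ≟ a))))
                              (cong (nonempty x *_) (indicator-∧ (does (x ≼? a)) (not (does (x ≟ a)))))) ⟩
      s * (nonempty x * (below * distinct))
        ≡⟨ ℕP.*-assoc s (nonempty x) (below * distinct) ⟨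
      s * nonempty x * (below * distinct)
        ≡⟨ cong (_* (below * distinct)) (surjections-*-nonempty k x) ⟩
      s * (below * distinct)
        ≡⟨ ℕP.*-comm s (below * distinct) ⟩
      below * distinct * s
        ≡⟨ ℕP.*-assoc below distinct s ⟩
      below * (distinct * s)
        ∎
      where
      s below distinct : ℕ
      s        = surjections (rank x) (suc k)
      below    = indicator (does (x ≼? a))
      distinct = indicator (not (does (x ≟ a)))

  ∑-by-rank : ∀ d → IsDim Δ d → (g : ℕ → ℕ) → ∑[ a < n ] g (rank a) ≡ Σ< (suc d) (λ i → fΔ Δ i * g i)
  ∑-by-rank d (rank≤d , _) g = begin
    ∑[ a < n ] g (rank a)
      ≡⟨ sum-cong-≗ (λ a → Σ<-select g (s≤s (rank≤d a))) ⟨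
    ∑[ a < n ] Σ< (suc d) (λ i → indicator (i ≡ᵇ rank a) * g i)
      ≡⟨ ∑-comm {n} {suc d} (λ a i → indicator (toℕ i ≡ᵇ rank a) * g (toℕ i)) ⟩
    Σ< (suc d) (λ i → ∑[ a < n ] (indicator (i ≡ᵇ rank a) * g i))
      ≡⟨ Σ<-cong (suc d) (λ i _ → *-distribʳ-sum {n} (g i) (λ a → indicator (i ≡ᵇ rank a))) ⟨
    Σ< (suc d) (λ i → ∑[ a < n ] indicator (i ≡ᵇ rank a) * g i)
      ≡⟨ Σ<-cong (suc d) (λ i _ → cong (_* g i) (sym (#rank≡ i))) ⟩
    Σ< (suc d) (λ i → fΔ Δ i * g i)
      ∎
    where
    open ≡-Reasoning
    #rank≡ : ∀ i → fΔ Δ i ≡ ∑[ a < n ] indicator (i ≡ᵇ rank a)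
    #rank≡ i = trans (count-allFin (λ a → ⌊ rank a ≟ℕ i ⌋)) (sum-cong-≗ (λ a → cong indicator
      (trans (isYes≗does (rank a ≟ℕ i)) (does-⇔ (mk⇔ sym sym) (rank a ≟ℕ i) (i ≟ℕ rank a)))))

  -- chains are enumerated from their bottom cell; ∑-walksFrom≡∑-walksTo regroups them by their top cell
  fsd≡Σ-fΔ-surjections : ∀ d → IsDim Δ d → ∀ k → fsd Δ k ≡ Σ< (suc d) (λ i → fΔ Δ i * surjections i k)
  fsd≡Σ-fΔ-surjections d dim zero = begin
    1
      ≡⟨ ∑-select ∅ (λ _ → 1) ⟨
    ∑[ a < n ] (indicator (does (∅ ≟ a)) * 1)
      ≡⟨ sum-cong-≗ (λ a → trans (ℕP.*-identityʳ _) (cong indicator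
           (trans (does-⇔ (mk⇔ sym sym) (∅ ≟ a) (a ≟ ∅)) (sym (rank≡ᵇ0 a))))) ⟩
    ∑[ a < n ] surjections (rank a) 0
      ≡⟨ ∑-by-rank d dim (λ i → surjections i 0) ⟩
    Σ< (suc d) (λ i → fΔ Δ i * surjections i 0)
      ∎
    where open ≡-Reasoning
  fsd≡Σ-fΔ-surjections d dim (suc k) = begin
    fsd Δ (suc k)
      ≡⟨ count-allVecs-suc n k (chain? Δ) ⟩
    ∑[ x < n ] count (λ w → chain? Δ (x ∷ w)) (allVecs n k)
      ≡⟨ sum-cong-≗ (λ x → trans (chainsFrom≡walksFrom k x) (sym (nonempty-*-walksFrom k x))) ⟩
    ∑[ x < n ] (nonempty x * walksFrom nonempty k x)
      ≡⟨ ∑-walksFrom≡∑-walksTo k nonempty nonempty ⟩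
    ∑[ a < n ] (walksTo nonempty k a * nonempty a)
      ≡⟨ sum-cong-≗ (λ a → trans (cong (_* nonempty a) (walksTo≡surjections k a))
                                  (surjections-*-nonempty k a)) ⟩
    ∑[ a < n ] surjections (rank a) (suc k)
      ≡⟨ ∑-by-rank d dim (λ i → surjections i (suc k)) ⟩
    Σ< (suc d) (λ i → fΔ Δ i * surjections i (suc k))
      ∎
    where open ≡-Reasoning

module ℤΣ = RangeSum ℤP.+-*-commutativeSemiring

module CoefficientSequences where

  open import Algebra.Properties.Ring ℤP.+-*-ring using (-1*x≈-x; x[y-z]≈xy-xz; [y-z]x≈yx-zx)
  open import Data.Integer using (ℤ; +_; -_; _+_; _-_; _*_; 0ℤ; -1ℤ)
  open import Data.Nat as ℕ using (zero; suc)
  open import Function using (_∘_)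
  open import Relation.Binary.PropositionalEquality
  open ℤΣ

  Σ<-neg : ∀ n (f : ℕ → ℤ) → Σ< n (λ i → - f i) ≡ - Σ< n f
  Σ<-neg n f = begin
    Σ< n (λ i → - f i)      ≡⟨ Σ<-cong n (λ i _ → -1*x≈-x (f i)) ⟨
    Σ< n (λ i → -1ℤ * f i)  ≡⟨ *-distribˡ-Σ< n -1ℤ f ⟨
    -1ℤ * Σ< n f            ≡⟨ -1*x≈-x _ ⟩
    - Σ< n f                ∎
    where open ≡-Reasoning

  Σ<-sub : ∀ n (f g : ℕ → ℤ) → Σ< n (λ i → f i - g i) ≡ Σ< n f - Σ< n g
  Σ<-sub n f g = trans (Σ<-distrib-+ n f (λ i → - g i)) (cong (λ x → Σ< n f + x) (Σ<-neg n g))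

  pos-Σ< : ∀ n (f : ℕ → ℕ) → + ℕΣ.Σ< n f ≡ Σ< n (+_ ∘ f)
  pos-Σ< zero    f = refl
  pos-Σ< (suc n) f = trans (ℤP.pos-+ (f 0) _) (cong (λ x → + f 0 + x) (pos-Σ< n (f ∘ suc)))

  pos-Σ<-* : ∀ n (a b : ℕ → ℕ) → + ℕΣ.Σ< n (λ i → a i ℕ.* b i) ≡ Σ< n (λ i → + b i * + a i)
  pos-Σ<-* n a b = trans (pos-Σ< n (λ i → a i ℕ.* b i))
    (Σ<-cong n (λ i _ → trans (ℤP.pos-* (a i) (b i)) (ℤP.*-comm (+ a i) (+ b i))))

  pos-shift : ∀ (f : ℕ → ℕ) j → + ℕΣ.shift f j ≡ shift (+_ ∘ f) j
  pos-shift f zero    = refl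
  pos-shift f (suc j) = refl

  [1-t]· : (ℕ → ℤ) → ℕ → ℤ
  [1-t]· f j = f j - shift f j

  Σ<-shift-*ʳ : ∀ n (g : ℕ → ℕ → ℤ) (c : ℕ → ℤ) j →
    Σ< n (λ k → shift (g k) j * c k) ≡ shift (λ j′ → Σ< n (λ k → g k j′ * c k)) j
  Σ<-shift-*ʳ n g c j =
    trans (Σ<-cong n (λ k _ → shift-*ʳ (g k) (c k) j)) (shift-Σ< n (λ k j′ → g k j′ * c k) j)

  [1-t]·-Σ< : ∀ n (g : ℕ → ℕ → ℤ) (c : ℕ → ℤ) j →
    Σ< n (λ k → [1-t]· (g k) j * c k) ≡ [1-t]· (λ j′ → Σ< n (λ k → g k j′ * c k)) j
  [1-t]·-Σ< n g c j = begin
    Σ< n (λ k → [1-t]· (g k) j * c k)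
      ≡⟨ Σ<-cong n (λ k _ → [y-z]x≈yx-zx (c k) (g k j) (shift (g k) j)) ⟩
    Σ< n (λ k → g k j * c k - shift (g k) j * c k)
      ≡⟨ Σ<-sub n (λ k → g k j * c k) (λ k → shift (g k) j * c k) ⟩
    Σ< n (λ k → g k j * c k) - Σ< n (λ k → shift (g k) j * c k)
      ≡⟨ cong (λ x → Σ< n (λ k → g k j * c k) - x) (Σ<-shift-*ʳ n g c j) ⟩
    [1-t]· (λ j′ → Σ< n (λ k → g k j′ * c k)) j
      ∎
    where open ≡-Reasoning

  Σ<-by-parts : ∀ n (a e : ℕ → ℤ) → e n ≡ 0ℤ →
    Σ< (suc n) (λ r → a r * [1-t]· e r) ≡ Σ< n (λ r → (a r - a (suc r)) * e r)
  Σ<-by-parts n a e eₙ≡0 = begin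
    Σ< (suc n) (λ r → a r * [1-t]· e r)
      ≡⟨ Σ<-cong (suc n) (λ r _ → x[y-z]≈xy-xz (a r) (e r) (shift e r)) ⟩
    Σ< (suc n) (λ r → a r * e r - a r * shift e r)
      ≡⟨ Σ<-sub (suc n) (λ r → a r * e r) (λ r → a r * shift e r) ⟩
    Σ< (suc n) ae - (a 0 * 0ℤ + Σ< n (λ r → a (suc r) * e r))
      ≡⟨ cong₂ _-_ drop-last drop-first ⟩
    Σ< n ae - Σ< n (λ r → a (suc r) * e r)
      ≡⟨ Σ<-sub n ae (λ r → a (suc r) * e r) ⟨
    Σ< n (λ r → a r * e r - a (suc r) * e r)
      ≡⟨ Σ<-cong n (λ r _ → [y-z]x≈yx-zx (e r) (a r) (a (suc r))) ⟨
    Σ< n (λ r → (a r - a (suc r)) * e r)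
      ∎
    where
    open ≡-Reasoning
    ae : ℕ → ℤ
    ae r = a r * e r
    drop-last : Σ< (suc n) ae ≡ Σ< n ae
    drop-last = begin
      Σ< (suc n) ae        ≡⟨ Σ<-last n ae ⟩
      Σ< n ae + a n * e n  ≡⟨ cong (λ x → Σ< n ae + a n * x) eₙ≡0 ⟩
      Σ< n ae + a n * 0ℤ   ≡⟨ cong (λ x → Σ< n ae + x) (ℤP.*-zeroʳ (a n)) ⟩
      Σ< n ae + 0ℤ         ≡⟨ ℤP.+-identityʳ _ ⟩
      Σ< n ae              ∎
    drop-first : a 0 * 0ℤ + Σ< n (λ r → a (suc r) * e r) ≡ Σ< n (λ r → a (suc r) * e r)
    drop-first = trans (cong (λ x → x + Σ< n (λ r → a (suc r) * e r)) (ℤP.*-zeroʳ (a 0))) (ℤP.+-identityˡ _)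

module HCoefficients where

  open import Data.Integer using (ℤ; +_; -_; _+_; _-_; _*_; 0ℤ)
  open import Data.Integer.Tactic.RingSolver using (solve-∀)
  open import Data.List using (foldr; applyUpTo)
  open import Data.Nat as ℕ using (zero; suc; _∸_; _≤_; _<_; s≤s; _≡ᵇ_; _<ᵇ_)
  open import Data.Nat.Combinatorics using (_C_; nCk+nC[k+1]≡[n+1]C[k+1]; k>n⇒nCk≡0; nCn≡1)
  open import Function using (_∘_)
  open import Relation.Binary.PropositionalEquality
  open import Defs using (sign; sumTo; hvec)
  open ℤΣ
  open CoefficientSequences

  sign-suc : ∀ j → sign (suc j) ≡ - sign j
  sign-suc zero    = refl
  sign-suc (suc j) = sym (trans (cong -_ (sign-suc j)) (ℤP.neg-involutive (sign j)))

  -- hCoeff n i j is the coefficient of t ^ j in t ^ i (1 - t) ^ n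
  hCoeff : ℕ → ℕ → ℕ → ℤ
  hCoeff n zero    j = sign j * + (n C j)
  hCoeff n (suc i) j = shift (hCoeff n i) j

  hCoeff-suc : ∀ n i j → hCoeff (suc n) i j ≡ [1-t]· (hCoeff n i) j
  hCoeff-suc n zero    zero    = refl
  hCoeff-suc n zero    (suc j) = begin
    sign (suc j) * + (suc n C suc j)
      ≡⟨ cong₂ _*_ (sign-suc j) (trans (cong +_ (sym (nCk+nC[k+1]≡[n+1]C[k+1] n j))) (ℤP.pos-+ (n C j) _)) ⟩
    - sign j * (+ (n C j) + + (n C suc j))
      ≡⟨ pascal (sign j) (+ (n C j)) (+ (n C suc j)) ⟩
    - sign j * + (n C suc j) - sign j * + (n C j)
      ≡⟨ cong (λ s → s * + (n C suc j) - sign j * + (n C j)) (sign-suc j) ⟨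
    [1-t]· (hCoeff n zero) (suc j)
      ∎
    where
    open ≡-Reasoning
    pascal : ∀ s x y → - s * (x + y) ≡ - s * y - s * x
    pascal = solve-∀
  hCoeff-suc n (suc i) zero    = refl
  hCoeff-suc n (suc i) (suc j) = hCoeff-suc n i j

  hCoeff-0 : ∀ i r → hCoeff 0 i r ≡ indicator (r ≡ᵇ i)
  hCoeff-0 zero    zero    = refl
  hCoeff-0 zero    (suc r) = ℤP.*-zeroʳ (sign (suc r))
  hCoeff-0 (suc i) zero    = refl
  hCoeff-0 (suc i) (suc r) = hCoeff-0 i r

  hCoeff-above : ∀ n i j → n ℕ.+ i < j → hCoeff n i j ≡ 0ℤ
  hCoeff-above n zero    j       n+0<j =
    trans (cong (λ c → sign j * + c) (k>n⇒nCk≡0 (subst (_< j) (ℕP.+-identityʳ n) n+0<j))) (ℤP.*-zeroʳ (sign j))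
  hCoeff-above n (suc i) zero    _     = refl
  hCoeff-above n (suc i) (suc j) n+i<j = hCoeff-above n i j (ℕP.≤-pred (subst (_< suc j) (ℕP.+-suc n i) n+i<j))

  hCoeff-below : ∀ n i j → j < i → hCoeff n i j ≡ 0ℤ
  hCoeff-below n (suc i) zero    _         = refl
  hCoeff-below n (suc i) (suc j) (s≤s j<i) = hCoeff-below n i j j<i

  hCoeff-closed : ∀ n i j → i ≤ j → hCoeff n i j ≡ sign (j ∸ i) * + (n C (j ∸ i))
  hCoeff-closed n zero    j       _         = refl
  hCoeff-closed n (suc i) (suc j) (s≤s i≤j) = hCoeff-closed n i j i≤j

  sumTo≡Σ< : ∀ m (g : ℕ → ℤ) → sumTo m g ≡ Σ< (suc m) g
  sumTo≡Σ< m g = foldr-applyUpTo (suc m) (λ i → i)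
    where
    foldr-applyUpTo : ∀ n (f : ℕ → ℕ) → foldr (λ i acc → g i + acc) 0ℤ (applyUpTo f n) ≡ Σ< n (g ∘ f)
    foldr-applyUpTo zero    f = refl
    foldr-applyUpTo (suc n) f = cong (λ x → g (f 0) + x) (foldr-applyUpTo n (f ∘ suc))

  hvec≡Σ-hCoeff : ∀ d f j → j ≤ d → hvec d f j ≡ Σ< (suc d) (λ i → hCoeff (d ∸ i) i j * + f i)
  hvec≡Σ-hCoeff d f j j≤d = begin
    hvec d f j
      ≡⟨ sumTo≡Σ< j (λ i → sign (j ∸ i) * (+ ((d ∸ i) C (j ∸ i)) * + f i)) ⟩
    Σ< (suc j) (λ i → sign (j ∸ i) * (+ ((d ∸ i) C (j ∸ i)) * + f i))
      ≡⟨ Σ<-cong (suc j) (λ i i≤j → trans (sym (ℤP.*-assoc (sign (j ∸ i)) _ (+ f i)))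
                                         (cong (_* + f i) (sym (hCoeff-closed (d ∸ i) i j (ℕP.≤-pred i≤j))))) ⟩
    Σ< (suc j) (λ i → hCoeff (d ∸ i) i j * + f i)
      ≡⟨ Σ<-truncate (λ i → hCoeff (d ∸ i) i j * + f i) (s≤s j≤d)
           (λ i j<i _ → cong (_* + f i) (hCoeff-below (d ∸ i) i j j<i)) ⟨
    Σ< (suc d) (λ i → hCoeff (d ∸ i) i j * + f i)
      ∎
    where open ≡-Reasoning

  -- Σ_{i<N} C(N,i) t^i (1-t)^(N-1-i) = ((t + (1 - t))^N - t^N) / (1 - t) = 1 + t + ⋯ + t^(N-1)
  geometric : ∀ N r → Σ< N (λ i → hCoeff (N ∸ suc i) i r * + (N C i)) ≡ indicator (r <ᵇ N)
  geometric zero    r = refl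
  geometric (suc N) r = begin
    hCoeff N 0 r * + 1 + Σ< N (λ i → e i * + (suc N C suc i))
      ≡⟨ cong (λ x → hCoeff N 0 r * + 1 + x) (trans (Σ<-cong N (λ i _ → pascal i)) (Σ<-distrib-+ N e·C e·C′)) ⟩
    hCoeff N 0 r * + 1 + (Σ< N e·C + Σ< N e·C′)
      ≡⟨ x+[y+z]≡[x+z]+y (hCoeff N 0 r * + 1) (Σ< N e·C) (Σ< N e·C′) ⟩
    Σ< (suc N) (λ i → hCoeff (N ∸ i) i r * + (N C i)) + Σ< N e·C
      ≡⟨ cong₂ _+_ unshifted (Σ<-shift-*ʳ N (λ i → hCoeff (N ∸ suc i) i) (λ i → + (N C i)) r) ⟩
    [1-t]· Z r + indicator (r ≡ᵇ N) + shift Z r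
      ≡⟨ [x-y+z]+y≡x+z (Z r) (shift Z r) (indicator (r ≡ᵇ N)) ⟩
    Z r + indicator (r ≡ᵇ N)
      ≡⟨ cong (_+ indicator (r ≡ᵇ N)) (geometric N r) ⟩
    indicator (r <ᵇ N) + indicator (r ≡ᵇ N)
      ≡⟨ <ᵇ-suc r N ⟩
    indicator (r <ᵇ suc N)
      ∎
    where
    open ≡-Reasoning
    Z : ℕ → ℤ
    Z r′ = Σ< N (λ i → hCoeff (N ∸ suc i) i r′ * + (N C i))
    e e·C e·C′ : ℕ → ℤ
    e i    = hCoeff (N ∸ suc i) (suc i) r
    e·C i  = e i * + (N C i)
    e·C′ i = e i * + (N C suc i)
    pascal : ∀ i → e i * + (suc N C suc i) ≡ e·C i + e·C′ i
    pascal i = trans (cong (e i *_) (trans (cong +_ (sym (nCk+nC[k+1]≡[n+1]C[k+1] N i))) (ℤP.pos-+ (N C i) _)))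
                     (ℤP.*-distribˡ-+ (e i) _ _)
    x+[y+z]≡[x+z]+y : ∀ x y z → x + (y + z) ≡ (x + z) + y
    x+[y+z]≡[x+z]+y = solve-∀
    [x-y+z]+y≡x+z : ∀ x y z → x - y + z + y ≡ x + z
    [x-y+z]+y≡x+z = solve-∀
    <ᵇ-suc : ∀ r N → indicator (r <ᵇ N) + indicator (r ≡ᵇ N) ≡ indicator (r <ᵇ suc N)
    <ᵇ-suc zero    zero    = refl
    <ᵇ-suc zero    (suc N) = refl
    <ᵇ-suc (suc r) zero    = refl
    <ᵇ-suc (suc r) (suc N) = <ᵇ-suc r N
    unshifted : Σ< (suc N) (λ i → hCoeff (N ∸ i) i r * + (N C i)) ≡ [1-t]· Z r + indicator (r ≡ᵇ N)
    unshifted = begin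
      Σ< (suc N) (λ i → hCoeff (N ∸ i) i r * + (N C i))
        ≡⟨ Σ<-last N (λ i → hCoeff (N ∸ i) i r * + (N C i)) ⟩
      Σ< N (λ i → hCoeff (N ∸ i) i r * + (N C i)) + hCoeff (N ∸ N) N r * + (N C N)
        ≡⟨ cong₂ _+_ (Σ<-cong N (λ i i<N → cong (λ m → hCoeff m i r * + (N C i)) (ℕP.+-∸-assoc 1 i<N)))
                     (cong₂ (λ m c → hCoeff m N r * + c) (ℕP.n∸n≡0 N) (nCn≡1 N)) ⟩
      Σ< N (λ i → hCoeff (suc (N ∸ suc i)) i r * + (N C i)) + hCoeff 0 N r * + 1
        ≡⟨ cong₂ _+_ (Σ<-cong N (λ i _ → cong (_* + (N C i)) (hCoeff-suc (N ∸ suc i) i r)))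
                     (trans (ℤP.*-identityʳ _) (hCoeff-0 N r)) ⟩
      Σ< N (λ i → [1-t]· (hCoeff (N ∸ suc i) i) r * + (N C i)) + indicator (r ≡ᵇ N)
        ≡⟨ cong (_+ indicator (r ≡ᵇ N)) ([1-t]·-Σ< N (λ i → hCoeff (N ∸ suc i) i) (λ i → + (N C i)) r) ⟩
      [1-t]· Z r + indicator (r ≡ᵇ N)
        ∎

module CellContributions where

  open import Data.Integer using (ℤ; +_; _+_; _-_; _*_; 0ℤ)
  open import Data.Integer.Tactic.RingSolver using (solve-∀)
  open import Data.Nat as ℕ using (zero; suc; _∸_; _≤_; s≤s; _<ᵇ_)
  open import Data.Nat.Combinatorics using (_C_)
  open import Data.Sum using (inj₁; inj₂)
  open import Function using (_∘_)
  open import Relation.Binary.PropositionalEquality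
  open import Defs using (A; sumTo; hvec)
  open ℤΣ
  open BooleanComparisons using (<ᵇ-true)
  open Permutations using (refinedEulerian; A≡refinedEulerian; refinedEulerian-step; refinedEulerian-last)
  open Surjections using (surjections; surjections-vanish)
  open CoefficientSequences
  open HCoefficients

  -- the contributions of one cell with i vertices to h_j(sd Δ) and to the right-hand side
  sdCoeff : ℕ → ℕ → ℕ → ℤ
  sdCoeff d i j = Σ< (suc i) (λ k → hCoeff (d ∸ k) k j * + surjections i k)

  eulerCoeff : ℕ → ℕ → ℕ → ℤ
  eulerCoeff d i j = Σ< (suc d) (λ r → + refinedEulerian (suc d) r j * hCoeff (d ∸ i) i r)

  suc-∸ : ∀ {d k} → k ≤ d → suc d ∸ k ≡ suc (d ∸ k)
  suc-∸ = ℕP.+-∸-assoc 1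

  Σ<-hCoeff-surjections : ∀ d m (c : ℕ → ℕ) j →
    Σ< (suc m) (λ k → hCoeff (d ∸ k) k j * + ℕΣ.Σ< (suc m) (λ i → c i ℕ.* surjections i k)) ≡
    Σ< (suc m) (λ i → sdCoeff d i j * + c i)
  Σ<-hCoeff-surjections d m c j = begin
    Σ< (suc m) (λ k → hCoeff (d ∸ k) k j * + ℕΣ.Σ< (suc m) (λ i → c i ℕ.* surjections i k))
      ≡⟨ Σ<-cong (suc m) (λ k _ → cong (hCoeff (d ∸ k) k j *_) (pos-Σ<-* (suc m) c (λ i → surjections i k))) ⟩
    Σ< (suc m) (λ k → hCoeff (d ∸ k) k j * Σ< (suc m) (λ i → + surjections i k * + c i))
      ≡⟨ Σ<-*-Σ<-comm (suc m) (suc m) (λ k → hCoeff (d ∸ k) k j) (λ k i → + surjections i k) (λ i → + c i) ⟩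
    Σ< (suc m) (λ i → Σ< (suc m) (λ k → hCoeff (d ∸ k) k j * + surjections i k) * + c i)
      ≡⟨ Σ<-cong (suc m) (λ i i≤m → cong (_* + c i)
           (Σ<-truncate (λ k → hCoeff (d ∸ k) k j * + surjections i k) i≤m
           (λ k i<k _ → trans (cong (λ s → hCoeff (d ∸ k) k j * + s) (surjections-vanish i<k))
                              (ℤP.*-zeroʳ (hCoeff (d ∸ k) k j))))) ⟩
    Σ< (suc m) (λ i → sdCoeff d i j * + c i)
      ∎
    where open ≡-Reasoning

  refinedEulerian-difference : ∀ d r j → r ≤ d →
    + refinedEulerian (suc (suc d)) r j - + refinedEulerian (suc (suc d)) (suc r) j ≡
    [1-t]· (λ j′ → + refinedEulerian (suc d) r j′) j
  refinedEulerian-difference d r j r≤d = begin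
    + a₂ r - + a₂ (suc r)
      ≡⟨ x+p≡y+q⇒x-y≡q-p (+ a₂ r) (+ a₂ (suc r)) (+ p) (+ q) step ⟩
    + q - + p
      ≡⟨ cong (λ x → + q - x) (pos-shift (refinedEulerian (suc d) r) j) ⟩
    [1-t]· (λ j′ → + refinedEulerian (suc d) r j′) j
      ∎
    where
    open ≡-Reasoning
    a₂ : ℕ → ℕ
    a₂ r′ = refinedEulerian (suc (suc d)) r′ j
    p q : ℕ
    p = ℕΣ.shift (refinedEulerian (suc d) r) j
    q = refinedEulerian (suc d) r j
    step : + a₂ r + + p ≡ + a₂ (suc r) + + q
    step = trans (sym (ℤP.pos-+ (a₂ r) p))
                 (trans (cong +_ (refinedEulerian-step d r j r≤d)) (ℤP.pos-+ (a₂ (suc r)) q))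
    x+p≡y+q⇒x-y≡q-p : ∀ x y p q → x + p ≡ y + q → x - y ≡ q - p
    x+p≡y+q⇒x-y≡q-p x y p q eq = begin
      x - y              ≡⟨ x-y≡[x+p]-[y+p] x y p ⟩
      (x + p) - (y + p)  ≡⟨ cong (λ z → z - (y + p)) eq ⟩
      (y + q) - (y + p)  ≡⟨ [y+q]-[y+p]≡q-p y q p ⟩
      q - p              ∎
      where
      x-y≡[x+p]-[y+p] : ∀ x y p → x - y ≡ (x + p) - (y + p)
      x-y≡[x+p]-[y+p] = solve-∀
      [y+q]-[y+p]≡q-p : ∀ y q p → (y + q) - (y + p) ≡ q - p
      [y+q]-[y+p]≡q-p = solve-∀

  sdCoeff-step : ∀ d i j → i ≤ d → sdCoeff (suc d) i j ≡ [1-t]· (sdCoeff d i) j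
  sdCoeff-step d i j i≤d = begin
    Σ< (suc i) (λ k → hCoeff (suc d ∸ k) k j * + surjections i k)
      ≡⟨ Σ<-cong (suc i) (λ k k≤i → cong (_* + surjections i k)
           (trans (cong (λ m → hCoeff m k j) (suc-∸ (ℕP.≤-trans (ℕP.≤-pred k≤i) i≤d)))
                  (hCoeff-suc (d ∸ k) k j))) ⟩
    Σ< (suc i) (λ k → [1-t]· (hCoeff (d ∸ k) k) j * + surjections i k)
      ≡⟨ [1-t]·-Σ< (suc i) (λ k → hCoeff (d ∸ k) k) (λ k → + surjections i k) j ⟩
    [1-t]· (sdCoeff d i) j
      ∎
    where open ≡-Reasoning

  eulerCoeff-step : ∀ d i j → i ≤ d → eulerCoeff (suc d) i j ≡ [1-t]· (eulerCoeff d i) j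
  eulerCoeff-step d i j i≤d = begin
    Σ< (suc (suc d)) (λ r → + a₂ r * hCoeff (suc d ∸ i) i r)
      ≡⟨ Σ<-cong (suc (suc d)) (λ r _ → cong (+ a₂ r *_)
           (trans (cong (λ m → hCoeff m i r) (suc-∸ i≤d)) (hCoeff-suc (d ∸ i) i r))) ⟩
    Σ< (suc (suc d)) (λ r → + a₂ r * [1-t]· (hCoeff (d ∸ i) i) r)
      ≡⟨ Σ<-by-parts (suc d) (λ r → + a₂ r) (hCoeff (d ∸ i) i)
           (hCoeff-above (d ∸ i) i (suc d) (s≤s (ℕP.≤-reflexive (ℕP.m∸n+n≡m i≤d)))) ⟩
    Σ< (suc d) (λ r → (+ a₂ r - + a₂ (suc r)) * hCoeff (d ∸ i) i r)
      ≡⟨ Σ<-cong (suc d) (λ r r≤d →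
           cong (_* hCoeff (d ∸ i) i r) (refinedEulerian-difference d r j (ℕP.≤-pred r≤d))) ⟩
    Σ< (suc d) (λ r → [1-t]· (λ j′ → + refinedEulerian (suc d) r j′) j * hCoeff (d ∸ i) i r)
      ≡⟨ [1-t]·-Σ< (suc d) (λ r j′ → + refinedEulerian (suc d) r j′) (hCoeff (d ∸ i) i) j ⟩
    [1-t]· (eulerCoeff d i) j
      ∎
    where
    open ≡-Reasoning
    a₂ : ℕ → ℕ
    a₂ r = refinedEulerian (suc (suc d)) r j

  sdCoeff-top : ∀ i j →
    sdCoeff (suc i) (suc i) j ≡ shift (λ j′ → Σ< (suc i) (λ i′ → sdCoeff i i′ j′ * + (suc i C i′))) j
  sdCoeff-top i j = begin
    hCoeff (suc i) 0 j * + 0 + rest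
      ≡⟨ trans (cong (_+ rest) (ℤP.*-zeroʳ (hCoeff (suc i) 0 j))) (ℤP.+-identityˡ rest) ⟩
    rest
      ≡⟨ Σ<-shift-*ʳ (suc i) (λ k → hCoeff (i ∸ k) k) (λ k → + surjections (suc i) (suc k)) j ⟩
    shift (λ j′ → Σ< (suc i) (λ k → hCoeff (i ∸ k) k j′ * + surjections (suc i) (suc k))) j
      ≡⟨ shift-cong (Σ<-hCoeff-surjections i i (suc i C_)) j ⟩
    shift (λ j′ → Σ< (suc i) (λ i′ → sdCoeff i i′ j′ * + (suc i C i′))) j
      ∎
    where
    open ≡-Reasoning
    rest : ℤ
    rest = Σ< (suc i) (λ k → shift (hCoeff (i ∸ k) k) j * + surjections (suc i) (suc k))

  eulerCoeff-top : ∀ i j →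
    eulerCoeff (suc i) (suc i) j ≡ shift (λ j′ → Σ< (suc i) (λ i′ → eulerCoeff i i′ j′ * + (suc i C i′))) j
  eulerCoeff-top i j = begin
    Σ< (suc (suc i)) (λ r → + a₂ r * hCoeff (i ∸ i) (suc i) r)
      ≡⟨ Σ<-cong (suc (suc i)) (λ r _ → trans (cong (λ m → + a₂ r * hCoeff m (suc i) r) (ℕP.n∸n≡0 i))
           (trans (cong (+ a₂ r *_) (hCoeff-0 (suc i) r)) (ℤP.*-comm (+ a₂ r) (indicator (r ℕ.≡ᵇ suc i))))) ⟩
    Σ< (suc (suc i)) (λ r → indicator (r ℕ.≡ᵇ suc i) * + a₂ r)
      ≡⟨ Σ<-select {ρ = suc i} (λ r → + a₂ r) ℕP.≤-refl ⟩
    + a₂ (suc i)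
      ≡⟨ trans (cong +_ (refinedEulerian-last i j)) (pos-Σ< (suc i) (λ r → ℕΣ.shift (a₁ r) j)) ⟩
    Σ< (suc i) (λ r → + ℕΣ.shift (a₁ r) j)
      ≡⟨ trans (Σ<-cong (suc i) (λ r _ → pos-shift (a₁ r) j)) (shift-Σ< (suc i) (λ r j′ → + a₁ r j′) j) ⟩
    shift (λ j′ → Σ< (suc i) (λ r → + a₁ r j′)) j
      ≡⟨ shift-cong expand j ⟩
    shift (λ j′ → Σ< (suc i) (λ i′ → eulerCoeff i i′ j′ * + (suc i C i′))) j
      ∎
    where
    open ≡-Reasoning
    a₁ : ℕ → ℕ → ℕ
    a₁ = refinedEulerian (suc i)
    a₂ : ℕ → ℕ
    a₂ r = refinedEulerian (suc (suc i)) r j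
    expand : ∀ j′ →
      Σ< (suc i) (λ r → + a₁ r j′) ≡ Σ< (suc i) (λ i′ → eulerCoeff i i′ j′ * + (suc i C i′))
    expand j′ = begin
      Σ< (suc i) (λ r → + a₁ r j′)
        ≡⟨ Σ<-cong (suc i) (λ r r<1+i → trans (sym (ℤP.*-identityʳ (+ a₁ r j′)))
             (cong (λ b → + a₁ r j′ * indicator b) (sym (<ᵇ-true r<1+i)))) ⟩
      Σ< (suc i) (λ r → + a₁ r j′ * indicator (r <ᵇ suc i))
        ≡⟨ Σ<-cong (suc i) (λ r _ → cong (+ a₁ r j′ *_) (geometric (suc i) r)) ⟨
      Σ< (suc i) (λ r → + a₁ r j′ * Σ< (suc i) (λ i′ → hCoeff (i ∸ i′) i′ r * + (suc i C i′)))
        ≡⟨ Σ<-*-Σ<-comm (suc i) (suc i) (λ r → + a₁ r j′) (λ r i′ → hCoeff (i ∸ i′) i′ r) (+_ ∘ (suc i C_)) ⟩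
      Σ< (suc i) (λ i′ → eulerCoeff i i′ j′ * + (suc i C i′))
        ∎

  sdCoeff≡eulerCoeff : ∀ d i j → i ≤ d → sdCoeff d i j ≡ eulerCoeff d i j
  sdCoeff≡eulerCoeff zero    zero    zero    _ = refl
  sdCoeff≡eulerCoeff zero    zero    (suc j) _ = cong (λ x → x * + 1 + 0ℤ) (hCoeff-0 0 (suc j))
  sdCoeff≡eulerCoeff (suc d) i       j       i≤1+d with ℕP.m≤n⇒m<n∨m≡n i≤1+d
  ... | inj₁ (s≤s i≤d) = begin
    sdCoeff (suc d) i j
      ≡⟨ sdCoeff-step d i j i≤d ⟩
    [1-t]· (sdCoeff d i) j
      ≡⟨ cong₂ _-_ (sdCoeff≡eulerCoeff d i j i≤d) (shift-cong (λ j′ → sdCoeff≡eulerCoeff d i j′ i≤d) j) ⟩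
    [1-t]· (eulerCoeff d i) j
      ≡⟨ eulerCoeff-step d i j i≤d ⟨
    eulerCoeff (suc d) i j
      ∎
    where open ≡-Reasoning
  ... | inj₂ refl = begin
    sdCoeff (suc d) (suc d) j
      ≡⟨ sdCoeff-top d j ⟩
    shift (λ j′ → Σ< (suc d) (λ i′ → sdCoeff d i′ j′ * + (suc d C i′))) j
      ≡⟨ shift-cong (λ j′ → Σ<-cong (suc d) (λ i′ i′≤d →
           cong (_* + (suc d C i′)) (sdCoeff≡eulerCoeff d i′ j′ (ℕP.≤-pred i′≤d)))) j ⟩
    shift (λ j′ → Σ< (suc d) (λ i′ → eulerCoeff d i′ j′ * + (suc d C i′))) j
      ≡⟨ eulerCoeff-top d j ⟨
    eulerCoeff (suc d) (suc d) j
      ∎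
    where open ≡-Reasoning

  hvec≡Σ-sdCoeff : ∀ d (f g : ℕ → ℕ) → (∀ k → g k ≡ ℕΣ.Σ< (suc d) (λ i → f i ℕ.* surjections i k)) →
    ∀ j → j ≤ d → hvec d g j ≡ Σ< (suc d) (λ i → sdCoeff d i j * + f i)
  hvec≡Σ-sdCoeff d f g g≡ j j≤d = begin
    hvec d g j
      ≡⟨ hvec≡Σ-hCoeff d g j j≤d ⟩
    Σ< (suc d) (λ k → hCoeff (d ∸ k) k j * + g k)
      ≡⟨ Σ<-cong (suc d) (λ k _ → cong (λ x → hCoeff (d ∸ k) k j * + x) (g≡ k)) ⟩
    Σ< (suc d) (λ k → hCoeff (d ∸ k) k j * + ℕΣ.Σ< (suc d) (λ i → f i ℕ.* surjections i k))
      ≡⟨ Σ<-hCoeff-surjections d d f j ⟩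
    Σ< (suc d) (λ i → sdCoeff d i j * + f i)
      ∎
    where open ≡-Reasoning

  Σ-eulerCoeff≡sumTo : ∀ d (f : ℕ → ℕ) j →
    Σ< (suc d) (λ i → eulerCoeff d i j * + f i) ≡ sumTo d (λ r → + A (suc d) j (suc r) * hvec d f r)
  Σ-eulerCoeff≡sumTo d f j = begin
    Σ< (suc d) (λ i → eulerCoeff d i j * + f i)
      ≡⟨ Σ<-*-Σ<-comm (suc d) (suc d) (λ r → + refinedEulerian (suc d) r j) (λ r i → hCoeff (d ∸ i) i r) (+_ ∘ f)
       ⟨
    Σ< (suc d) (λ r → + refinedEulerian (suc d) r j * Σ< (suc d) (λ i → hCoeff (d ∸ i) i r * + f i))
      ≡⟨ Σ<-cong (suc d) (λ r r≤d → cong₂ _*_ (cong +_ (sym (A≡refinedEulerian d r j (ℕP.≤-pred r≤d))))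
                                              (sym (hvec≡Σ-hCoeff d f r (ℕP.≤-pred r≤d)))) ⟩
    Σ< (suc d) (λ r → + A (suc d) j (suc r) * hvec d f r)
      ≡⟨ sumTo≡Σ< d (λ r → + A (suc d) j (suc r) * hvec d f r) ⟨
    sumTo d (λ r → + A (suc d) j (suc r) * hvec d f r)
      ∎
    where open ≡-Reasoning

open import Data.Integer using (+_; _*_)
open import Data.Nat using (suc; _≤_)
open import Relation.Binary.PropositionalEquality using (_≡_; cong; module ≡-Reasoning)
open import Defs using (IsDim; hvec; fsd; fΔ; sumTo; A)
open ℤΣ using (Σ<; Σ<-cong)
open CellContributions
open Chains using (fsd≡Σ-fΔ-surjections)

theorem2p2 : (n : ℕ) (Δ : BooleanCellComplex n) (d : ℕ) → IsDim Δ d →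
    (j : ℕ) → j ≤ d →
    hvec d (fsd Δ) j ≡ sumTo d (λ r → + A (suc d) j (suc r) * hvec d (fΔ Δ) r)
theorem2p2 n Δ d dim j j≤d = begin
  hvec d (fsd Δ) j
    ≡⟨ hvec≡Σ-sdCoeff d (fΔ Δ) (fsd Δ) (fsd≡Σ-fΔ-surjections Δ d dim) j j≤d ⟩
  Σ< (suc d) (λ i → sdCoeff d i j * + fΔ Δ i)
    ≡⟨ Σ<-cong (suc d) (λ i i≤d → cong (_* + fΔ Δ i) (sdCoeff≡eulerCoeff d i j (ℕP.≤-pred i≤d))) ⟩
  Σ< (suc d) (λ i → eulerCoeff d i j * + fΔ Δ i)
    ≡⟨ Σ-eulerCoeff≡sumTo d (fΔ Δ) j ⟩
  sumTo d (λ r → + A (suc d) j (suc r) * hvec d (fΔ Δ) r)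
    ∎
  where open ≡-Reasoning
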